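{- Let $\boldsymbol{\mu}$ be an $\boldsymbol{l}$-partition of $\boldsymbol{m}$, $\rho$ a partition of $m$, $j$ an integer, and $\boldsymbol{\gamma}=(\gamma_h)$ with $\gamma_h$ the order of $a_{\mu^{(h)},l_h}^{j}$. Then $(Y,c)\mapsto\{\varphi_j(Y,c)\}$ is a bijection from the set of marked $(\rho,\boldsymbol{\gamma},\boldsymbol{l})$-tabloids on $\boldsymbol{\mu}$ onto the set of tabloids $\{\boldsymbol{T}\}$ on $\boldsymbol{\mu}$ satisfying $\sigma_\rho\{\boldsymbol{T}\}=\{\boldsymbol{T}\}a_{\boldsymbol{\mu},\boldsymbol{l}}^{ -j}$.
   Context: A partition $\mu$ is identified with its Young diagram $\{(i,j)\in\mathbb{N}^2:1\le j\le\mu_i\}$ (box $(i,j)$ in row $i$, column $j$). For a positive integer $l$, $\mu$ is an $l$-partition if for every $i$ the number of $k$ with $\mu_k=i$ is divisible by $l$. Fix $n$-tuples $\boldsymbol{m}=(m_h)$, $\boldsymbol{l}=(l_h)$ of positive integers, $m=\sum_h m_h$. An $\boldsymbol{l}$-partition of $\boldsymbol{m}$ is $\boldsymbol{\mu}=(\mu^{(1)},\ldots,\mu^{(n)})$ with $\mu^{(h)}$ an $l_h$-partition of $m_h$; boxes are triples $(i,j;h)$. A numbering is a bijection $\boldsymbol{T}$ from boxes to $\{1,\ldots,m\}$; the standard numbering $\boldsymbol{t}_{\boldsymbol{\mu}}$ fills $1,\ldots,m$ row by row left to right, top to bottom, in $\mu^{(1)}$, then $\mu^{(2)}$, etc. Numberings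 are row-equivalent if each row of each component has the same set of entries; classes $\{\boldsymbol{T}\}$ are tabloids. $S_m$ acts on the left by $\sigma\{\boldsymbol{T}\}=\{\sigma\circ\boldsymbol{T}\}$. For a single $l$-partition $\mu$ with standard numbering $t_\mu$, $a_{\mu,l}$ is the product over boxes $(lq+1,j)\in\mu$ of the cycles $(t_\mu(lq+1,j),\ldots,t_\mu(lq+l,j))$; $a_{\boldsymbol{\mu},\boldsymbol{l}}\in S_m$ is the product over all $h$ and boxes $(l_hq+1,j;h)$ of the cycles $(\boldsymbol{t}_{\boldsymbol{\mu}}(l_hq+1,j;h),\ldots,\boldsymbol{t}_{\boldsymbol{\mu}}(l_hq+l_h,j;h))$. The group $\langle a_{\boldsymbol{\mu},\boldsymbol{l}}\rangle$ acts on the right: writing $\boldsymbol{T}=\tau_{\boldsymbol{T}}\circ\boldsymbol{t}_{\boldsymbol{\mu}}$, $\boldsymbol{T}\sigma=\tau_{\boldsymbol{T}}\sigma\circ\boldsymbol{t}_{\boldsymbol{\mu}}$, $\{\boldsymbol{T}\}\sigma=\{\boldsymbol{T}\sigma\}$ (row $\bar r+l_hq$ of $\mu^{(h)}$ in $\boldsymbol{T}a_{\boldsymbol{\mu},\boldsymbol{l}}$ is row $\overline{r+1}+l_hq$ of $\boldsymbol{T}$, residues in $\{1,\ldots,l_h\}$). For a partition $\rho$ of $m$ and positive integers $\gamma_h\mid l_h$, a $(\rho,\boldsymbol{\gamma},\boldsymbol{l})$-tabloid on $\boldsymbol{\mu}$ is a map $Y$ from boxes to $\mathbb{N}$ with: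 (i) $|Y^{ -1}(k)|=\rho_k$ for all $k$; (ii) for each $k$ there exist $h$ and $(i',j')\in\mathbb{N}^2$ with $\gamma_h\mid\rho_k$ and $Y^{ -1}(k)=\{(s\,l_h/\gamma_h+i',t+j';h):1\le s\le\gamma_h,1\le t\le\rho_k/\gamma_h\}$; (iii) $Y(i,j;h)\le Y(i,k;h)$ whenever $j\le k$. A marked one is a pair $(Y,c)$ with $c:\{i:\rho_i\ne0\}\to\coprod_h\mathbb{Z}/\gamma_h\mathbb{Z}$, $c(i)\in\mathbb{Z}/\gamma_h\mathbb{Z}$ whenever $Y^{ -1}(i)\subset\mu^{(h)}$. Let $n_{\rho,i}=1+\sum_{k<i}\rho_k$, $N_{\rho,i}=\{n_{\rho,i},\ldots,n_{\rho,i}+\rho_i-1\}$, $\sigma_{\rho,i}=(n_{\rho,i},n_{\rho,i}+1,\ldots,n_{\rho,i}+\rho_i-1)$, $\sigma_\rho=\sigma_{\rho,1}\sigma_{\rho,2}\cdots\in S_m$. For a marked $(\rho,\boldsymbol{\gamma},\boldsymbol{l})$-tabloid $(Y,c)$, $\{\varphi_j(Y,c)\}$ is the tabloid obtained as follows: for each $i$ with $\rho_i\ne0$, where $Y^{ -1}(i)\subset\mu^{(h)}$, put $n_{\rho,i}$ in the $c(i)$-th row (counted from the top, $c(i)$ read in $\{1,\ldots,\gamma_h\}$) among the $\gamma_h$ rows of $Y^{ -1}(i)$; and whenever a number $n$ is in the $(\bar c+ql_h)$-th row of $\mu^{(h)}$ ($\bar c\in\{1,\ldots,l_h\}$, $q\in\mathbb{Z}$),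 put $\sigma_\rho(n)$ in the $(\overline{c-j}+ql_h)$-th row of $\mu^{(h)}$, where $\overline{c-j}\in\{1,\ldots,l_h\}$ is congruent to $\bar c-j$ mod $l_h$. $\varphi_j(Y,c)$ is the representative numbering with entries increasing along each row. -}

module Defs where

open import Data.Nat as ℕ using (ℕ; zero; suc; _+_; _*_; _≤_; _<_; _≥_; _≟_; _/_; _%_)
open import Data.Nat.Divisibility using (_∣_)
open import Data.Integer as ℤ using (ℤ; +_; _%ℕ_)
open import Data.Fin as Fin using (Fin; toℕ; splitAt; _↑ˡ_; _↑ʳ_; fromℕ; inject₁; cast)
open import Data.List as List using (List; []; _∷_; length; lookup; filter; map; concatMap; deduplicate; allFin; tabulate)
open import Data.Nat.ListAction using (sum)
open import Data.List.Relation.Unary.All using (All)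
open import Data.List.Relation.Unary.Linked using (Linked)
open import Data.Product using (Σ; Σ-syntax; _×_; _,_; proj₁; proj₂)
open import Data.Product.Properties using (≡-dec)
open import Data.Sum using (inj₁; inj₂)
open import Relation.Binary.PropositionalEquality using (_≡_; sym)
open import Relation.Nullary using (¬_; Dec)
open import Relation.Unary using (Decidable)

count : {A : Set} {P : A → Set} → Decidable P → List A → ℕ
count P? xs = length (filter P? xs)

at : List ℕ → ℕ → ℕ
at [] _ = 0
at (x ∷ _) zero = x
at (_ ∷ xs) (suc i) = at xs i

-- natural-number division (a / b); only used with b ≥ 1
div : ℕ → ℕ → ℕ
div a zero = 0
div a (suc k) = a / suc k

-- Partitions, given as the list of their parts (μ₁, μ₂, …).
-- Rows/columns are 0-based in this file: paper row i is row i ∸ 1 here.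

IsPartition : List ℕ → ℕ → Set
IsPartition p k = Linked _≥_ p × All (0 <_) p × sum p ≡ k

IsLPartition : ℕ → List ℕ → Set
IsLPartition l p = ∀ i → l ∣ count (_≟ i) p

-- The permutation a_{μ,l} sends the entry in box (r, col) to box
-- (rowShift l 1 r, col) (via t_μ); hence a^d acts on boxes by rowShift l d.
rowShift : ℕ → ℤ → ℕ → ℕ
rowShift zero d r = r
rowShift (suc k) d r = (r / suc k) * suc k + ((+ (r % suc k)) ℤ.+ d) %ℕ suc k

PowerIsId : ℕ → List ℕ → ℤ → Set
PowerIsId l p d = ∀ r col → col < at p r → rowShift l d r ≡ r

IsOrderOfPower : ℕ → List ℕ → ℤ → ℕ → Set
IsOrderOfPower l p j γ =
  0 < γ × PowerIsId l p (j ℤ.* + γ) × (∀ k → 0 < k → k < γ → ¬ PowerIsId l p (j ℤ.* + k))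

cycPred : {p : ℕ} → Fin p → Fin p
cycPred {suc p} Fin.zero = fromℕ p
cycPred {suc p} (Fin.suc a) = inject₁ a

-- For a list of parts ρ and x ∈ {0,…,Σρ - 1}: the (0-based) i with
-- x+1 ∈ N_{ρ,i+1}, together with the offset t = x+1 - n_{ρ,i+1}.
locate : (ps : List ℕ) → Fin (sum ps) → Fin (length ps) × ℕ
locate [] ()
locate (p ∷ ps) x with splitAt p x
... | inj₁ a = Fin.zero , toℕ a
... | inj₂ b with locate ps b
...   | i , t = Fin.suc i , t

-- σ_ρ⁻¹ (0-based numbers): inverse of the product of the cycles
-- (n_{ρ,i}, n_{ρ,i}+1, …, n_{ρ,i}+ρ_i-1)
σinv : (ps : List ℕ) → Fin (sum ps) → Fin (sum ps)
σinv [] ()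
σinv (p ∷ ps) x with splitAt p x
... | inj₁ a = cycPred a ↑ˡ sum ps
... | inj₂ b = p ↑ʳ σinv ps b

module Setup {n : ℕ} (μ : Fin n → List ℕ) (l γ : Fin n → ℕ) (ρ : List ℕ) (j : ℤ)
             (m : ℕ) (ρm : sum ρ ≡ m) where

  Box : Set
  Box = Σ[ h ∈ Fin n ] Σ[ i ∈ Fin (length (μ h)) ] Fin (lookup (μ h) i)

  allBoxes : List Box
  allBoxes = concatMap (λ h → concatMap (λ i → map (λ c → h , i , c) (allFin _))
                                         (allFin _)) (allFin n)

  coords : Box → Fin n × ℕ × ℕ
  coords (h , i , c) = h , toℕ i , toℕ c

  rowOf : Box → ℕ
  rowOf (h , i , c) = toℕ i

  -- the values k of Y (paper: 1,2,…,length ρ; here 0-based Fin (length ρ))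
  K : Set
  K = Fin (length ρ)

  ρ_ : K → ℕ
  ρ_ k = lookup ρ k

  record MarkedTabloid : Set where
    field
      Y : Box → K
      card : ∀ k → count (λ b → Y b Fin.≟ k) allBoxes ≡ ρ_ k
      shape : ∀ k → Σ[ h ∈ Fin n ] Σ[ i₀ ∈ ℕ ] Σ[ j₀ ∈ ℕ ]
        ( γ h ∣ ρ_ k
        × (∀ b → Y b ≡ k → Σ[ s ∈ ℕ ] Σ[ t ∈ ℕ ]
              (s < γ h × t < div (ρ_ k) (γ h)
               × coords b ≡ (h , i₀ + s * div (l h) (γ h) , j₀ + t)))
        × (∀ s t → s < γ h → t < div (ρ_ k) (γ h) → Σ[ b ∈ Box ]
              (coords b ≡ (h , i₀ + s * div (l h) (γ h) , j₀ + t) × Y b ≡ k)))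
      rowWeak : ∀ h i (a b : Fin (lookup (μ h) i)) → a Fin.≤ b → Y (h , i , a) Fin.≤ Y (h , i , b)
      -- the marking c : {k} → ∐_h ℤ/γ_hℤ  (ℤ/γℤ represented by Fin γ, v ↦ [v+1])
      c : K → Σ[ h ∈ Fin n ] Fin (γ h)
      c-comp : ∀ k b → Y b ≡ k → proj₁ b ≡ proj₁ (c k)

  open MarkedTabloid public

  SameMarked : MarkedTabloid → MarkedTabloid → Set
  SameMarked P Q = (∀ b → Y P b ≡ Y Q b) × (∀ k → c P k ≡ c Q k)

  Row : Set
  Row = Fin n × ℕ

  rowLen : Row → ℕ
  rowLen (h , i) = at (μ h) i

  -- A tabloid {T} on μ is represented by the map sending each number
  -- (0-based, Fin m) to the row containing it; the rows must have the right sizes.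
  IsTabloid : (Fin m → Row) → Set
  IsTabloid f = ∀ R → count (λ x → ≡-dec Fin._≟_ _≟_ (f x) R) (allFin m) ≡ rowLen R

  shiftRow : ℤ → Row → Row
  shiftRow d (h , r) = h , rowShift (l h) d r

  σρ⁻¹ : Fin m → Fin m
  σρ⁻¹ y = cast ρm (σinv ρ (cast (sym ρm) y))

  -- σ_ρ{T} = {T} a^{-j}:
  --   row of y in σ_ρ{T} is the row of σ_ρ⁻¹(y) in {T};
  --   row of y in {T}a^{-j} is rowShift (+j) of its row in {T}.
  Cond : (Fin m → Row) → Set
  Cond f = ∀ y → f (σρ⁻¹ y) ≡ shiftRow j (f y)

  -- rows (ascending, without repetition) of Y⁻¹(k)
  rowsOf : (Box → K) → K → List ℕ
  rowsOf Y' k = deduplicate _≟_ (map rowOf (filter (λ b → Y' b Fin.≟ k) allBoxes))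

  -- {φ_j(Y,c)}: number n_{ρ,k} + t goes to the row obtained from the
  -- c(k)-th row of Y⁻¹(k) by t steps of the shift by -j
  φ : MarkedTabloid → Fin m → Row
  φ P x with locate ρ (cast (sym ρm) x)
  ... | k , t with c P k
  ...   | h , v = h , rowShift (l h) (ℤ.- (j ℤ.* + t)) (at (rowsOf (Y P) k) (toℕ v))

-- a_{μ,l}^j shifts the rows in each block of l consecutive rows of μ cyclically by j, so its orbits on rows
-- are the progressions i, i + d, …, i + (γ - 1) d inside one block, where d = l / γ. In a marked tabloid each
-- Y⁻¹(k) fills ρ_k / γ columns of such an orbit (its top row is the first row of the orbit, by induction on
-- the top row, since μ is a partition), and φ_j(Y, c) sends n_{ρ,k}, …, n_{ρ,k} + ρ_k - 1 around that orbit,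
-- visiting each of its rows ρ_k / γ times. Counting gives the row lengths of {φ_j(Y, c)}, and following the
-- cycle of σ_ρ against the shift by -j gives σ_ρ{T} = {T}a^{-j}. Conversely, that condition forces the rows
-- of n_{ρ,k} + t (t = 0, 1, …) to walk around an orbit, with γ ∣ ρ_k. Filling every row with the values k
-- in increasing order, each as often as this walk visits the row, gives the unique preimage: the rows of Y
-- are weakly increasing, so the row counts determine Y, and c is read off from the row of n_{ρ,k}.
module Submission where

open import Defs
open import Data.Nat using (ℕ; _<_; _≥_; NonZero)
open import Data.Nat.ListAction using (sum)
open import Data.Integer using (ℤ)
open import Data.Fin using (Fin)
open import Data.List using (List; tabulate)
open import Data.List.Relation.Unary.All using (All)
open import Data.List.Relation.Unary.Linked using (Linked)
open import Data.Product using (Σ; Σ-syntax; _×_; proj₁; proj₂; _,_)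
open import Relation.Binary.PropositionalEquality using (_≡_)
open import Function using (_∘_)

module FiniteSums where

  open import Data.Nat
  open import Data.Nat.Properties
  open import Data.Fin as F using (Fin; toℕ; _↑ˡ_; _↑ʳ_)
  open import Data.Fin.Properties as FP using (pigeonhole; punchOut-injective; any?)
  open import Data.Product using (∃; _,_; proj₁; proj₂)
  open import Data.Empty using (⊥-elim)
  open import Relation.Nullary using (Dec; yes; no; ¬_)
  open import Relation.Nullary.Decidable using (_×-dec_)
  open import Relation.Binary.PropositionalEquality
  open import Function using (_∘_)
  open import Algebra.Properties.CommutativeMonoid.Sum +-0-commutativeMonoid public
    using (sum-syntax; sum-cong-≗; ∑-comm; sum-replicate-zero)

  χ : ∀ {a} {A : Set a} → Dec A → ℕ
  χ (yes _) = 1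
  χ (no _) = 0

  module _ {a} {A : Set a} where

    χ-yes : (d : Dec A) → A → χ d ≡ 1
    χ-yes (yes _) _ = refl
    χ-yes (no ¬a) a = ⊥-elim (¬a a)

    χ-no : (d : Dec A) → ¬ A → χ d ≡ 0
    χ-no (yes a) ¬a = ⊥-elim (¬a a)
    χ-no (no _) _ = refl

    χ>0⇒ : (d : Dec A) → 0 < χ d → A
    χ>0⇒ (yes a) _ = a

    χ-⇔ : ∀ {b} {B : Set b} (d : Dec A) (e : Dec B) → (A → B) → (B → A) → χ d ≡ χ e
    χ-⇔ (yes _) (yes _) f g = refl
    χ-⇔ (yes a) (no ¬b) f g = ⊥-elim (¬b (f a))
    χ-⇔ (no ¬a) (yes b) f g = ⊥-elim (¬a (g b))
    χ-⇔ (no _) (no _) f g = refl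

    χ-× : ∀ {b} {B : Set b} (d : Dec A) (e : Dec B) → χ (d ×-dec e) ≡ χ d * χ e
    χ-× (yes _) (yes _) = refl
    χ-× (yes _) (no _) = refl
    χ-× (no _) (yes _) = refl
    χ-× (no _) (no _) = refl

  -- Unfolds definitionally: sumTo (suc N) f = f 0 + sumTo N (f ∘ suc).
  sumTo : ℕ → (ℕ → ℕ) → ℕ
  sumTo N f = ∑[ i < N ] f (toℕ i)

  ∑-zero : ∀ N {f : Fin N → ℕ} → (∀ i → f i ≡ 0) → ∑[ i < N ] f i ≡ 0
  ∑-zero N f≗0 = trans (sum-cong-≗ f≗0) (sum-replicate-zero N)

  ∑-single : ∀ N (f : Fin N → ℕ) i₀ → (∀ i → i ≢ i₀ → f i ≡ 0) → ∑[ i < N ] f i ≡ f i₀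
  ∑-single (suc N) f F.zero f≗0 = trans (cong (f F.zero +_) (∑-zero N (λ i → f≗0 (F.suc i) λ ()))) (+-identityʳ _)
  ∑-single (suc N) f (F.suc i₀) f≗0 = cong₂ _+_ (f≗0 F.zero λ ())
    (∑-single N (λ i → f (F.suc i)) i₀ λ i i≢i₀ → f≗0 (F.suc i) (i≢i₀ ∘ FP.suc-injective))

  ≤-∑ : ∀ N (f : Fin N → ℕ) i → f i ≤ ∑[ i < N ] f i
  ≤-∑ (suc N) f F.zero = m≤m+n _ _
  ≤-∑ (suc N) f (F.suc i) = ≤-trans (≤-∑ N (λ i → f (F.suc i)) i) (m≤n+m _ (f F.zero))

  ∑-↑ : ∀ a b (f : Fin (a + b) → ℕ) → ∑[ i < a + b ] f i ≡ ∑[ i < a ] f (i ↑ˡ b) + ∑[ i < b ] f (a ↑ʳ i)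
  ∑-↑ zero b f = refl
  ∑-↑ (suc a) b f = trans (cong (f F.zero +_) (∑-↑ a b (λ i → f (F.suc i)))) (sym (+-assoc (f F.zero) _ _))

  ∑-χ-≟ : ∀ K (k₀ : Fin K) → ∑[ k < K ] χ (k₀ F.≟ k) ≡ 1
  ∑-χ-≟ K k₀ = trans (∑-single K _ k₀ λ k k≢k₀ → χ-no (k₀ F.≟ k) (k≢k₀ ∘ sym)) (χ-yes (k₀ F.≟ k₀) refl)

  ∑-const : ∀ N c → ∑[ i < N ] c ≡ N * c
  ∑-const zero c = refl
  ∑-const (suc N) c = cong (c +_) (∑-const N c)

  ∑-fibres : ∀ K L (g : Fin L → Fin K) → ∑[ k < K ] ∑[ c < L ] χ (g c F.≟ k) ≡ L
  ∑-fibres K L g = begin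
    ∑[ k < K ] ∑[ c < L ] χ (g c F.≟ k)  ≡⟨ ∑-comm (λ k c → χ (g c F.≟ k)) ⟩
    ∑[ c < L ] ∑[ k < K ] χ (g c F.≟ k)  ≡⟨ sum-cong-≗ (λ c → ∑-χ-≟ K (g c)) ⟩
    ∑[ c < L ] 1                         ≡⟨ ∑-const L 1 ⟩
    L * 1                                ≡⟨ *-identityʳ L ⟩
    L                                    ∎
    where open ≡-Reasoning

  sumTo-cong : ∀ N {f g : ℕ → ℕ} → (∀ t → t < N → f t ≡ g t) → sumTo N f ≡ sumTo N g
  sumTo-cong N f≗g = sum-cong-≗ (λ i → f≗g (toℕ i) (FP.toℕ<n i))

  sumTo-zero : ∀ N {f : ℕ → ℕ} → (∀ t → t < N → f t ≡ 0) → sumTo N f ≡ 0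
  sumTo-zero N f≗0 = ∑-zero N (λ i → f≗0 (toℕ i) (FP.toℕ<n i))

  ≤-sumTo : ∀ N (f : ℕ → ℕ) t → t < N → f t ≤ sumTo N f
  ≤-sumTo N f t t<N = subst (λ s → f s ≤ sumTo N f) (FP.toℕ-fromℕ< t<N) (≤-∑ N _ (F.fromℕ< t<N))

  sumTo-+ : ∀ a b (f : ℕ → ℕ) → sumTo (a + b) f ≡ sumTo a f + sumTo b (λ t → f (a + t))
  sumTo-+ zero b f = refl
  sumTo-+ (suc a) b f = trans (cong (f 0 +_) (sumTo-+ a b (λ t → f (suc t)))) (sym (+-assoc (f 0) _ _))

  sumTo-periodic : ∀ w p (f : ℕ → ℕ) → (∀ t → f (p + t) ≡ f t) → sumTo (w * p) f ≡ w * sumTo p f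
  sumTo-periodic zero p f periodic = refl
  sumTo-periodic (suc w) p f periodic = begin
    sumTo (p + w * p) f                          ≡⟨ sumTo-+ p (w * p) f ⟩
    sumTo p f + sumTo (w * p) (λ t → f (p + t))  ≡⟨ cong (sumTo p f +_) (sumTo-cong (w * p) (λ t _ → periodic t)) ⟩
    sumTo p f + sumTo (w * p) f                  ≡⟨ cong (sumTo p f +_) (sumTo-periodic w p f periodic) ⟩
    sumTo p f + w * sumTo p f                    ∎
    where open ≡-Reasoning

  sumTo-χ-unique : ∀ N {P : ℕ → Set} (P? : ∀ t → Dec (P t)) t₀ → t₀ < N → P t₀
                 → (∀ t → t < N → P t → t ≡ t₀) → sumTo N (λ t → χ (P? t)) ≡ 1
  sumTo-χ-unique (suc N) P? zero _ p unique =
    cong₂ _+_ (χ-yes (P? 0) p) (sumTo-zero N λ t t<N → χ-no (P? (suc t)) λ q → 1+n≢0 (unique (suc t) (s≤s t<N) q))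
  sumTo-χ-unique (suc N) P? (suc t₀) (s≤s t₀<N) p unique =
    cong₂ _+_ (χ-no (P? 0) λ q → 0≢1+n (unique 0 z<s q))
              (sumTo-χ-unique N (λ t → P? (suc t)) t₀ t₀<N p λ t t<N q → suc-injective (unique (suc t) (s≤s t<N) q))

  sumTo-interval : ∀ L a w → a + w ≤ L → sumTo L (λ c → χ (a ≤? c) * χ (c <? a + w)) ≡ w
  sumTo-interval L zero zero _ =
    sumTo-zero L λ t _ → trans (cong (χ (0 ≤? t) *_) (χ-no (t <? 0) λ ())) (*-zeroʳ (χ (0 ≤? t)))
  sumTo-interval (suc L) zero (suc w) (s≤s w≤L) = cong suc (trans
    (sumTo-cong L λ t _ → cong₂ _*_ (χ-⇔ (0 ≤? suc t) (0 ≤? t) (λ _ → z≤n) (λ _ → z≤n))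
                                    (χ-⇔ (suc t <? suc w) (t <? w) s<s⁻¹ s<s))
    (sumTo-interval L zero w w≤L))
  sumTo-interval (suc L) (suc a) w (s≤s a+w≤L) = trans
    (cong₂ _+_ (cong (_* χ (0 <? suc (a + w))) (χ-no (suc a ≤? 0) λ ()))
               (sumTo-cong L λ t _ → cong₂ _*_ (χ-⇔ (suc a ≤? suc t) (a ≤? t) s≤s⁻¹ s≤s)
                                               (χ-⇔ (suc t <? suc (a + w)) (t <? a + w) s<s⁻¹ s<s)))
    (sumTo-interval L a w a+w≤L)

  injective⇒surjective : ∀ n (f : Fin n → Fin n) → (∀ x y → f x ≡ f y → x ≡ y) → ∀ y → ∃ λ x → f x ≡ y
  injective⇒surjective (suc n) f injective y with any? (λ x → f x F.≟ y)
  ... | yes hit = hit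
  ... | no miss = ⊥-elim (<-irrefl (cong toℕ (injective x x' fx≡fx')) x<x')
    where
      avoid-y : Fin (suc n) → Fin n
      avoid-y x = F.punchOut {i = y} {j = f x} (λ y≡fx → miss (x , sym y≡fx))
      collision = pigeonhole (n<1+n n) avoid-y
      x = proj₁ collision
      x' = proj₁ (proj₂ collision)
      x<x' = proj₁ (proj₂ (proj₂ collision))
      fx≡fx' : f x ≡ f x'
      fx≡fx' = punchOut-injective (λ e → miss (x , sym e)) (λ e → miss (x' , sym e)) (proj₂ (proj₂ (proj₂ collision)))

module RowShift where

  open import Data.Nat as ℕ using (ℕ; zero; suc; _≤_; _<_; s≤s; NonZero)
  open import Data.Nat.Properties as ℕP using ()
  open import Data.Nat.DivMod
  open import Data.Nat.Divisibility using (_∣_; divides; n∣m*n)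
  open import Data.Integer as ℤ using (ℤ; +_; -[1+_]; _%ℕ_; _/ℕ_)
  open import Data.Integer.Properties as ℤP using (pos-+; pos-*; +-injective)
  open import Data.Integer.DivMod using (a≡a%ℕn+[a/ℕn]*n; n%ℕd<d)
  open import Data.Integer.Solver using (module +-*-Solver)
  open import Data.Empty using (⊥; ⊥-elim)
  open import Relation.Nullary using (yes; no)
  open import Relation.Binary.PropositionalEquality
  open import Defs using (rowShift; div)
  open +-*-Solver
  open ≡-Reasoning

  ∣⇒≡div* : ∀ {a b} → 0 < b → b ∣ a → a ≡ div a b ℕ.* b
  ∣⇒≡div* {b = suc b} _ (divides q refl) = cong (ℕ._* suc b) (sym (m*n/n≡m q (suc b)))

  div-nonZero : ∀ a b .{{_ : NonZero b}} → div a b ≡ a / b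
  div-nonZero a (suc b) = refl

  rowShift-nonZero : ∀ L .{{_ : NonZero L}} e r → rowShift L e r ≡ (r / L) ℕ.* L ℕ.+ (+ (r % L) ℤ.+ e) %ℕ L
  rowShift-nonZero (suc k) e r = refl

  module _ (L : ℕ) .{{_ : NonZero L}} where

    [qL+b]%L≡b : ∀ q b → b < L → (q ℕ.* L ℕ.+ b) % L ≡ b
    [qL+b]%L≡b q b b<L = begin
      (q ℕ.* L ℕ.+ b) % L  ≡⟨ cong (_% L) (ℕP.+-comm (q ℕ.* L) b) ⟩
      (b ℕ.+ q ℕ.* L) % L  ≡⟨ [m+kn]%n≡m%n b q L ⟩
      b % L                ≡⟨ m<n⇒m%n≡m b<L ⟩
      b                    ∎

    [qL+b]/L≡q : ∀ q b → b < L → (q ℕ.* L ℕ.+ b) / L ≡ q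
    [qL+b]/L≡q q b b<L = begin
      (q ℕ.* L ℕ.+ b) / L    ≡⟨ cong (_/ L) (ℕP.+-comm (q ℕ.* L) b) ⟩
      (b ℕ.+ q ℕ.* L) / L    ≡⟨ +-distrib-/-∣ʳ b (n∣m*n q) ⟩
      b / L ℕ.+ q ℕ.* L / L  ≡⟨ cong₂ ℕ._+_ (m<n⇒m/n≡0 b<L) (m*n/n≡m q L) ⟩
      q                      ∎

    m≡[m/n]*n+m%n : ∀ m → m ≡ (m / L) ℕ.* L ℕ.+ m % L
    m≡[m/n]*n+m%n m = trans (m≡m%n+[m/n]*n m L) (ℕP.+-comm (m % L) _)

    %-+ˡ : ∀ x a → (x % L ℕ.+ a) % L ≡ (x ℕ.+ a) % L
    %-+ˡ x a = begin
      (x % L ℕ.+ a) % L          ≡⟨ %-distribˡ-+ (x % L) a L ⟩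
      (x % L % L ℕ.+ a % L) % L  ≡⟨ cong (λ z → (z ℕ.+ a % L) % L) (m%n%n≡m%n x L) ⟩
      (x % L ℕ.+ a % L) % L      ≡⟨ %-distribˡ-+ x a L ⟨
      (x ℕ.+ a) % L              ∎

    %-+ʳ : ∀ x a → (x ℕ.+ a % L) % L ≡ (x ℕ.+ a) % L
    %-+ʳ x a = begin
      (x ℕ.+ a % L) % L  ≡⟨ cong (_% L) (ℕP.+-comm x (a % L)) ⟩
      (a % L ℕ.+ x) % L  ≡⟨ %-+ˡ a x ⟩
      (a ℕ.+ x) % L      ≡⟨ cong (_% L) (ℕP.+-comm a x) ⟩
      (x ℕ.+ a) % L      ∎

    [a+e]%L≡a⇒e≡0 : ∀ a e → a < L → e < L → (a ℕ.+ e) % L ≡ a → e ≡ 0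
    [a+e]%L≡a⇒e≡0 a e a<L e<L eq with a ℕ.+ e ℕP.<? L
    ... | yes a+e<L = ℕP.+-cancelˡ-≡ a e 0 (trans (sym (m<n⇒m%n≡m a+e<L)) (trans eq (sym (ℕP.+-identityʳ a))))
    ... | no a+e≮L = ⊥-elim (ℕP.<-irrefl (sym L≡e) e<L)
      where
        L≤a+e : L ≤ a ℕ.+ e
        L≤a+e = ℕP.≮⇒≥ a+e≮L
        a+e∸L<L : a ℕ.+ e ℕ.∸ L < L
        a+e∸L<L = ℕP.+-cancelʳ-< _ _ L (subst (ℕ._< L ℕ.+ L) (sym (ℕP.m∸n+n≡m L≤a+e)) (ℕP.+-mono-< a<L e<L))
        a+e∸L≡a : a ℕ.+ e ℕ.∸ L ≡ a
        a+e∸L≡a = trans (sym (m<n⇒m%n≡m a+e∸L<L)) (trans (m≤n⇒[n∸m]%m≡n%m L≤a+e) eq)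
        L≡e : L ≡ e
        L≡e = sym (ℕP.+-cancelˡ-≡ a e L (trans (sym (ℕP.m∸n+n≡m L≤a+e)) (cong (ℕ._+ L) a+e∸L≡a)))

    private
      residue-unique : ∀ {b b'} (q q' : ℤ) → b < L → b' < L → + b ℤ.+ q ℤ.* + L ≡ + b' ℤ.+ q' ℤ.* + L → b ≡ b'
      residue-unique {b} {b'} q q' b<L b'<L eq = by-difference (q' ℤ.- q) b≡b'+δL
        where
          b≡b'+δL : + b ≡ + b' ℤ.+ (q' ℤ.- q) ℤ.* + L
          b≡b'+δL = begin
            + b
              ≡⟨ solve 3 (λ x y z → x := (x :+ y :* z) :- y :* z) refl (+ b) q (+ L) ⟩
            (+ b ℤ.+ q ℤ.* + L) ℤ.- q ℤ.* + L
              ≡⟨ cong (ℤ._- q ℤ.* + L) eq ⟩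
            (+ b' ℤ.+ q' ℤ.* + L) ℤ.- q ℤ.* + L
              ≡⟨ solve 4 (λ x y z w → (x :+ y :* w) :- z :* w := x :+ (y :- z) :* w) refl (+ b') q' q (+ L) ⟩
            + b' ℤ.+ (q' ℤ.- q) ℤ.* + L
              ∎
          too-big : ∀ {x} y s → x ≡ y ℕ.+ suc s ℕ.* L → x < L → ⊥
          too-big {x} y s refl x<L =
            ℕP.<-irrefl refl (ℕP.≤-trans (s≤s (ℕP.≤-trans (ℕP.m≤m+n L (s ℕ.* L)) (ℕP.m≤n+m _ y))) x<L)
          by-difference : (δ : ℤ) → + b ≡ + b' ℤ.+ δ ℤ.* + L → b ≡ b'
          by-difference (+ zero) e = trans (+-injective e) (ℕP.+-identityʳ b')
          by-difference (+ suc s) e = ⊥-elim (too-big b' s (+-injective (begin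
            + b                        ≡⟨ e ⟩
            + b' ℤ.+ + suc s ℤ.* + L   ≡⟨ cong (ℤ._+_ (+ b')) (pos-* (suc s) L) ⟨
            + b' ℤ.+ + (suc s ℕ.* L)   ≡⟨ pos-+ b' _ ⟨
            + (b' ℕ.+ suc s ℕ.* L)     ∎)) b<L)
          by-difference -[1+ s ] e = ⊥-elim (too-big b s (+-injective (begin
            + b'
              ≡⟨ solve 3 (λ x y z → x := (x :+ (:- y) :* z) :+ y :* z) refl (+ b') (+ suc s) (+ L) ⟩
            (+ b' ℤ.+ -[1+ s ] ℤ.* + L) ℤ.+ + suc s ℤ.* + L
              ≡⟨ cong (ℤ._+ + suc s ℤ.* + L) (sym e) ⟩
            + b ℤ.+ + suc s ℤ.* + L
              ≡⟨ trans (cong (ℤ._+_ (+ b)) (sym (pos-* (suc s) L))) (sym (pos-+ b _)) ⟩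
            + (b ℕ.+ suc s ℕ.* L)
              ∎)) b'<L)

    %ℕ-unique : ∀ x c (q : ℤ) → x ≡ + c ℤ.+ q ℤ.* + L → x %ℕ L ≡ c % L
    %ℕ-unique x c q x≡c+qL = sym (residue-unique (+ (c / L) ℤ.+ q) (x /ℕ L) (m%n<n c L) (n%ℕd<d x L)
                                   (trans (sym x≡c%L+[c/L+q]L) (a≡a%ℕn+[a/ℕn]*n x L)))
      where
        x≡c%L+[c/L+q]L : x ≡ + (c % L) ℤ.+ (+ (c / L) ℤ.+ q) ℤ.* + L
        x≡c%L+[c/L+q]L = begin
          x
            ≡⟨ x≡c+qL ⟩
          + c ℤ.+ q ℤ.* + L
            ≡⟨ cong (λ z → + z ℤ.+ q ℤ.* + L) (m≡m%n+[m/n]*n c L) ⟩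
          + (c % L ℕ.+ c / L ℕ.* L) ℤ.+ q ℤ.* + L
            ≡⟨ cong (ℤ._+ q ℤ.* + L) (trans (pos-+ (c % L) _) (cong (ℤ._+_ (+ (c % L))) (pos-* (c / L) L))) ⟩
          (+ (c % L) ℤ.+ + (c / L) ℤ.* + L) ℤ.+ q ℤ.* + L
            ≡⟨ solve 4 (λ a b q l → (a :+ b :* l) :+ q :* l := a :+ (b :+ q) :* l) refl (+ (c % L)) (+ (c / L)) q (+ L) ⟩
          + (c % L) ℤ.+ (+ (c / L) ℤ.+ q) ℤ.* + L
            ∎

    %ℕ-distrib-+ : ∀ a b → (a ℤ.+ b) %ℕ L ≡ (a %ℕ L ℕ.+ b %ℕ L) % L
    %ℕ-distrib-+ a b = %ℕ-unique (a ℤ.+ b) (a %ℕ L ℕ.+ b %ℕ L) (a /ℕ L ℤ.+ b /ℕ L) (begin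
      a ℤ.+ b
        ≡⟨ cong₂ ℤ._+_ (a≡a%ℕn+[a/ℕn]*n a L) (a≡a%ℕn+[a/ℕn]*n b L) ⟩
      (+ (a %ℕ L) ℤ.+ (a /ℕ L) ℤ.* + L) ℤ.+ (+ (b %ℕ L) ℤ.+ (b /ℕ L) ℤ.* + L)
        ≡⟨ solve 5 (λ x y p q l → (x :+ p :* l) :+ (y :+ q :* l) := (x :+ y) :+ (p :+ q) :* l) refl
                   (+ (a %ℕ L)) (+ (b %ℕ L)) (a /ℕ L) (b /ℕ L) (+ L) ⟩
      (+ (a %ℕ L) ℤ.+ + (b %ℕ L)) ℤ.+ (a /ℕ L ℤ.+ b /ℕ L) ℤ.* + L
        ≡⟨ cong (ℤ._+ (a /ℕ L ℤ.+ b /ℕ L) ℤ.* + L) (pos-+ (a %ℕ L) (b %ℕ L)) ⟨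
      + (a %ℕ L ℕ.+ b %ℕ L) ℤ.+ (a /ℕ L ℤ.+ b /ℕ L) ℤ.* + L
        ∎)

    %ℕ-distrib-* : ∀ a t → (a ℤ.* + t) %ℕ L ≡ (a %ℕ L ℕ.* t) % L
    %ℕ-distrib-* a t = %ℕ-unique (a ℤ.* + t) (a %ℕ L ℕ.* t) ((a /ℕ L) ℤ.* + t) (begin
      a ℤ.* + t
        ≡⟨ cong (ℤ._* + t) (a≡a%ℕn+[a/ℕn]*n a L) ⟩
      (+ (a %ℕ L) ℤ.+ (a /ℕ L) ℤ.* + L) ℤ.* + t
        ≡⟨ solve 4 (λ x p l t → (x :+ p :* l) :* t := x :* t :+ (p :* t) :* l) refl (+ (a %ℕ L)) (a /ℕ L) (+ L) (+ t) ⟩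
      + (a %ℕ L) ℤ.* + t ℤ.+ ((a /ℕ L) ℤ.* + t) ℤ.* + L
        ≡⟨ cong (ℤ._+ ((a /ℕ L) ℤ.* + t) ℤ.* + L) (pos-* (a %ℕ L) t) ⟨
      + (a %ℕ L ℕ.* t) ℤ.+ ((a /ℕ L) ℤ.* + t) ℤ.* + L
        ∎)

    -- rowShift L e, with e already reduced mod L
    shift : ℕ → ℕ → ℕ
    shift e r = (r / L) ℕ.* L ℕ.+ (r % L ℕ.+ e) % L

    rowShift≡shift : ∀ e r → rowShift L e r ≡ shift (e %ℕ L) r
    rowShift≡shift e r = begin
      rowShift L e r                                ≡⟨ rowShift-nonZero L e r ⟩
      (r / L) ℕ.* L ℕ.+ (+ (r % L) ℤ.+ e) %ℕ L      ≡⟨ cong ((r / L) ℕ.* L ℕ.+_) (%ℕ-distrib-+ (+ (r % L)) e) ⟩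
      (r / L) ℕ.* L ℕ.+ (r % L % L ℕ.+ e %ℕ L) % L  ≡⟨ cong (λ z → r / L ℕ.* L ℕ.+ (z ℕ.+ e %ℕ L) % L) (m%n%n≡m%n r L) ⟩
      shift (e %ℕ L) r                              ∎

    shift-/ : ∀ e r → shift e r / L ≡ r / L
    shift-/ e r = [qL+b]/L≡q (r / L) _ (m%n<n (r % L ℕ.+ e) L)

    shift-% : ∀ e r → shift e r % L ≡ (r % L ℕ.+ e) % L
    shift-% e r = [qL+b]%L≡b (r / L) _ (m%n<n (r % L ℕ.+ e) L)

    ≡shift : ∀ e r R → R / L ≡ r / L → R % L ≡ (r % L ℕ.+ e) % L → R ≡ shift e r
    ≡shift e r R R/L≡r/L R%L≡ = trans (m≡[m/n]*n+m%n R) (cong₂ (λ a b → a ℕ.* L ℕ.+ b) R/L≡r/L R%L≡)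

    shift-0 : ∀ r → shift 0 r ≡ r
    shift-0 r = sym (≡shift 0 r r refl (sym (trans (cong (_% L) (ℕP.+-identityʳ (r % L))) (m%n%n≡m%n r L))))

    shift-+ : ∀ a b r → shift a (shift b r) ≡ shift ((b ℕ.+ a) % L) r
    shift-+ a b r = ≡shift ((b ℕ.+ a) % L) r _ (trans (shift-/ a (shift b r)) (shift-/ b r)) (begin
      shift a (shift b r) % L        ≡⟨ shift-% a (shift b r) ⟩
      (shift b r % L ℕ.+ a) % L      ≡⟨ cong (λ z → (z ℕ.+ a) % L) (shift-% b r) ⟩
      ((r % L ℕ.+ b) % L ℕ.+ a) % L  ≡⟨ %-+ˡ (r % L ℕ.+ b) a ⟩
      (r % L ℕ.+ b ℕ.+ a) % L        ≡⟨ cong (_% L) (ℕP.+-assoc (r % L) b a) ⟩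
      (r % L ℕ.+ (b ℕ.+ a)) % L      ≡⟨ %-+ʳ (r % L) (b ℕ.+ a) ⟨
      (r % L ℕ.+ (b ℕ.+ a) % L) % L  ∎)

    rowShift-fixed⇒ : ∀ e r → rowShift L e r ≡ r → e %ℕ L ≡ 0
    rowShift-fixed⇒ e r fixed = [a+e]%L≡a⇒e≡0 (r % L) (e %ℕ L) (m%n<n r L) (n%ℕd<d e L)
      (trans (sym (shift-% (e %ℕ L) r)) (cong (_% L) (trans (sym (rowShift≡shift e r)) fixed)))

    rowShift-fixed⇐ : ∀ e r → e %ℕ L ≡ 0 → rowShift L e r ≡ r
    rowShift-fixed⇐ e r e%L≡0 = trans (rowShift≡shift e r) (trans (cong (λ z → shift z r) e%L≡0) (shift-0 r))

  rowShift-+ : ∀ L a b r → rowShift L a (rowShift L b r) ≡ rowShift L (a ℤ.+ b) r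
  rowShift-+ zero a b r = refl
  rowShift-+ L@(suc _) a b r = begin
    rowShift L a (rowShift L b r)          ≡⟨ rowShift≡shift L a (rowShift L b r) ⟩
    shift L (a %ℕ L) (rowShift L b r)      ≡⟨ cong (shift L (a %ℕ L)) (rowShift≡shift L b r) ⟩
    shift L (a %ℕ L) (shift L (b %ℕ L) r)  ≡⟨ shift-+ L (a %ℕ L) (b %ℕ L) r ⟩
    shift L ((b %ℕ L ℕ.+ a %ℕ L) % L) r    ≡⟨ cong (λ z → shift L (z % L) r) (ℕP.+-comm (b %ℕ L) (a %ℕ L)) ⟩
    shift L ((a %ℕ L ℕ.+ b %ℕ L) % L) r    ≡⟨ cong (λ z → shift L z r) (%ℕ-distrib-+ L a b) ⟨
    shift L ((a ℤ.+ b) %ℕ L) r             ≡⟨ rowShift≡shift L (a ℤ.+ b) r ⟨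
    rowShift L (a ℤ.+ b) r                 ∎

  rowShift-0 : ∀ L r → rowShift L (+ 0) r ≡ r
  rowShift-0 zero r = refl
  rowShift-0 L@(suc _) r = trans (rowShift≡shift L (+ 0) r) (shift-0 L r)

  rowShift-inverseˡ : ∀ L e r → rowShift L (ℤ.- e) (rowShift L e r) ≡ r
  rowShift-inverseˡ L e r =
    trans (rowShift-+ L (ℤ.- e) e r) (trans (cong (λ e → rowShift L e r) (ℤP.+-inverseˡ e)) (rowShift-0 L r))

  rowShift-inverseʳ : ∀ L e r → rowShift L e (rowShift L (ℤ.- e) r) ≡ r
  rowShift-inverseʳ L e r =
    trans (rowShift-+ L e (ℤ.- e) r) (trans (cong (λ e → rowShift L e r) (ℤP.+-inverseʳ e)) (rowShift-0 L r))

module ShiftOrbits (L : ℕ) .{{_ : NonZero L}} (j : ℤ) (p : List ℕ) (γ : ℕ)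
                   (order : IsOrderOfPower L p j γ) (p-nonempty : 0 < at p 0) where

  open import Data.Nat
  open import Data.Nat.Properties
  open import Data.Nat.DivMod
  open import Data.Nat.Divisibility using (_∣_; divides; ∣n⇒∣m*n; ∣m⇒∣m*n; m%n≡0⇒n∣m; n∣m⇒m%n≡0)
  open import Data.Integer as ℤ using (+_; _%ℕ_)
  open import Data.Fin as F using (Fin; toℕ; fromℕ<)
  open import Data.Fin.Properties using (toℕ<n; toℕ-fromℕ<; toℕ-injective)
  open import Data.Product using (∃; _×_; _,_; proj₁; proj₂)
  open import Data.Sum using (inj₁; inj₂)
  open import Data.Empty using (⊥-elim)
  open import Relation.Nullary using (¬_; Dec; yes; no)
  open import Relation.Nullary.Decidable using (_×-dec_)
  open import Relation.Binary.PropositionalEquality hiding (J)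
  open import Function using (_∘_)
  open import Algebra.Properties.CommutativeSemigroup *-commutativeSemigroup using () renaming (x∙yz≈y∙xz to *-leftComm)
  open import Defs using (rowShift; div)
  open FiniteSums
  open RowShift
  open ≡-Reasoning

  γ>0 : 0 < γ
  γ>0 = proj₁ order

  instance
    γ-nonZero : NonZero γ
    γ-nonZero = >-nonZero γ>0

  J : ℕ
  J = j %ℕ L

  private
    J*t-fixes⇒ : ∀ t → rowShift L (j ℤ.* + t) 0 ≡ 0 → (J * t) % L ≡ 0
    J*t-fixes⇒ t fixed = trans (sym (%ℕ-distrib-* L j t)) (rowShift-fixed⇒ L (j ℤ.* + t) 0 fixed)

    J*t-fixes⇐ : ∀ t r → (J * t) % L ≡ 0 → rowShift L (j ℤ.* + t) r ≡ r
    J*t-fixes⇐ t r Jt≡0 = rowShift-fixed⇐ L (j ℤ.* + t) r (trans (%ℕ-distrib-* L j t) Jt≡0)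

    Jγ≡0 : (J * γ) % L ≡ 0
    Jγ≡0 = J*t-fixes⇒ γ (proj₁ (proj₂ order) 0 0 p-nonempty)

    J*t≢0 : ∀ t → 0 < t → t < γ → (J * t) % L ≢ 0
    J*t≢0 t t>0 t<γ Jt≡0 = proj₂ (proj₂ order) t t>0 t<γ (λ r _ _ → J*t-fixes⇐ t r Jt≡0)

    L∣Jγ : L ∣ J * γ
    L∣Jγ = m%n≡0⇒n∣m (J * γ) L Jγ≡0

    L∣J*qγ : ∀ q → L ∣ J * (q * γ)
    L∣J*qγ q = subst (L ∣_) (*-leftComm q J γ) (∣n⇒∣m*n q L∣Jγ)

  J*t≡0⇒γ∣t : ∀ t → (J * t) % L ≡ 0 → γ ∣ t
  J*t≡0⇒γ∣t t Jt≡0 with t % γ ≟ 0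
  ... | yes t%γ≡0 = m%n≡0⇒n∣m t γ t%γ≡0
  ... | no t%γ≢0 = ⊥-elim (J*t≢0 (t % γ) (n≢0⇒n>0 t%γ≢0) (m%n<n t γ) J[t%γ]≡0)
    where
      J[t%γ]≡0 : (J * (t % γ)) % L ≡ 0
      J[t%γ]≡0 = begin
        (J * (t % γ)) % L                    ≡⟨ %-remove-+ʳ (J * (t % γ)) (L∣J*qγ (t / γ)) ⟨
        (J * (t % γ) + J * (t / γ * γ)) % L  ≡⟨ cong (_% L) (*-distribˡ-+ J (t % γ) (t / γ * γ)) ⟨
        (J * (t % γ + t / γ * γ)) % L        ≡⟨ cong (λ z → (J * z) % L) (m≡m%n+[m/n]*n t γ) ⟨
        (J * t) % L                          ≡⟨ Jt≡0 ⟩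
        0                                    ∎

  rowShift-order⇒ : ∀ t r → γ ∣ t → rowShift L (j ℤ.* + t) r ≡ r
  rowShift-order⇒ t r (divides q refl) = J*t-fixes⇐ t r (n∣m⇒m%n≡0 (J * (q * γ)) L (L∣J*qγ q))

  rowShift-order⇐ : ∀ t r → rowShift L (j ℤ.* + t) r ≡ r → γ ∣ t
  rowShift-order⇐ t r fixed = J*t≡0⇒γ∣t t (trans (sym (%ℕ-distrib-* L j t)) (rowShift-fixed⇒ L (j ℤ.* + t) r fixed))

  d : ℕ
  d = div L γ

  d*γ≡L : d * γ ≡ L
  d*γ≡L = trans (cong (_* γ) (div-nonZero L γ)) (m/n*n≡m (J*t≡0⇒γ∣t L (m*n%n≡0 J L)))

  γ*d≡L : γ * d ≡ L
  γ*d≡L = trans (*-comm γ d) d*γ≡L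

  d>0 : 0 < d
  d>0 = n≢0⇒n>0 λ d≡0 → ≢-nonZero⁻¹ L (trans (sym d*γ≡L) (cong (_* γ) d≡0))

  instance
    d-nonZero : NonZero d
    d-nonZero = >-nonZero d>0

  private
    d≤L : d ≤ L
    d≤L = subst (d ≤_) d*γ≡L (m≤m*n d γ)

    d∣L : d ∣ L
    d∣L = divides γ (sym γ*d≡L)

    d∣J : d ∣ J
    d∣J = cancel-γ L∣Jγ
      where
        cancel-γ : L ∣ J * γ → d ∣ J
        cancel-γ (divides c Jγ≡cL) = divides c (*-cancelʳ-≡ J (c * d) γ (begin
          J * γ        ≡⟨ Jγ≡cL ⟩
          c * L        ≡⟨ cong (c *_) d*γ≡L ⟨
          c * (d * γ)  ≡⟨ *-assoc c d γ ⟨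
          c * d * γ    ∎))

    %L%d : ∀ u → u % L % d ≡ u % d
    %L%d u = m∣n⇒o%n%m≡o%m d L u d∣L

    /d<γ : ∀ u → u < L → u / d < γ
    /d<γ u u<L = m<n*o⇒m/o<n (subst (u <_) (sym γ*d≡L) u<L)

    ≡-by-/d-%d : ∀ u u' → u / d ≡ u' / d → u % d ≡ u' % d → u ≡ u'
    ≡-by-/d-%d u u' /d-eq %d-eq = begin
      u                    ≡⟨ m≡[m/n]*n+m%n d u ⟩
      u / d * d + u % d    ≡⟨ cong₂ (λ x y → x * d + y) /d-eq %d-eq ⟩
      u' / d * d + u' % d  ≡⟨ m≡[m/n]*n+m%n d u' ⟨
      u'                   ∎

  -- t ↦ (a + J t) mod L is the residue of a row after t shifts by j
  walk : ℕ → ℕ → ℕ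
  walk a t = (a + J * t) % L

  walk-%d : ∀ a t → walk a t % d ≡ a % d
  walk-%d a t = trans (%L%d (a + J * t)) (%-remove-+ʳ a (∣m⇒∣m*n t d∣J))

  private
    walk-injective-≤ : ∀ a {t t'} → t ≤ t' → t' < γ → walk a t ≡ walk a t' → t ≡ t'
    walk-injective-≤ a {t} {t'} t≤t' t'<γ eq = sym (begin
      t'           ≡⟨ m+[n∸m]≡n t≤t' ⟨
      t + δ        ≡⟨ cong (_+_ t) δ≡0 ⟩
      t + 0        ≡⟨ +-identityʳ t ⟩
      t            ∎)
      where
        δ = t' ∸ t
        x = a + J * t
        x+Jδ : x + J * δ ≡ a + J * t'
        x+Jδ = trans (+-assoc a (J * t) (J * δ)) (cong (_+_ a) (trans (sym (*-distribˡ-+ J t δ)) (cong (J *_) (m+[n∸m]≡n t≤t'))))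
        Jδ≡0 : (J * δ) % L ≡ 0
        Jδ≡0 = [a+e]%L≡a⇒e≡0 L (x % L) ((J * δ) % L) (m%n<n x L) (m%n<n (J * δ) L) (begin
          (x % L + (J * δ) % L) % L  ≡⟨ %-+ʳ L (x % L) (J * δ) ⟩
          (x % L + J * δ) % L        ≡⟨ %-+ˡ L x (J * δ) ⟩
          (x + J * δ) % L            ≡⟨ cong (_% L) x+Jδ ⟩
          walk a t'                  ≡⟨ eq ⟨
          x % L                      ∎)
        δ≡0 : δ ≡ 0
        δ≡0 with J*t≡0⇒γ∣t δ Jδ≡0
        ... | divides zero δ≡0 = δ≡0
        ... | divides (suc q) δ≡γ+qγ =
          ⊥-elim (<⇒≱ (≤-<-trans (m∸n≤m t' t) t'<γ) (subst (γ ≤_) (sym δ≡γ+qγ) (m≤m+n γ (q * γ))))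

  walk-injective : ∀ a {t t'} → t < γ → t' < γ → walk a t ≡ walk a t' → t ≡ t'
  walk-injective a {t} {t'} t<γ t'<γ eq with ≤-total t t'
  ... | inj₁ t≤t' = walk-injective-≤ a t≤t' t'<γ eq
  ... | inj₂ t'≤t = sym (walk-injective-≤ a t'≤t t<γ (sym eq))

  -- γ distinct values among the γ residues ≡ a (mod d) below L: by pigeonhole the walk hits all of them
  walk-surjective : ∀ a b → b < L → a % d ≡ b % d → ∃ λ t → t < γ × walk a t ≡ b
  walk-surjective a b b<L a≡b = toℕ t , toℕ<n t , ≡-by-/d-%d (walk a (toℕ t)) b /d-eq (trans (walk-%d a (toℕ t)) a≡b)
    where
      index : Fin γ → Fin γ
      index x = fromℕ< (/d<γ (walk a (toℕ x)) (m%n<n _ L))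
      index-injective : ∀ x y → index x ≡ index y → x ≡ y
      index-injective x y eq = toℕ-injective (walk-injective a (toℕ<n x) (toℕ<n y)
        (≡-by-/d-%d _ _ (trans (sym (toℕ-fromℕ< _)) (trans (cong toℕ eq) (toℕ-fromℕ< _)))
                        (trans (walk-%d a (toℕ x)) (sym (walk-%d a (toℕ y))))))
      hit = injective⇒surjective γ index index-injective (fromℕ< (/d<γ b b<L))
      t = proj₁ hit
      /d-eq : walk a (toℕ t) / d ≡ b / d
      /d-eq = trans (sym (toℕ-fromℕ< _)) (trans (cong toℕ (proj₂ hit)) (toℕ-fromℕ< _))

  count-walk : ∀ a b → b < L → sumTo γ (λ t → χ (walk a t ≟ b)) ≡ χ (a % d ≟ b % d)
  count-walk a b b<L with a % d ≟ b % d
  ... | yes a≡b = let (t₀ , t₀<γ , hit) = walk-surjective a b b<L a≡b in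
    sumTo-χ-unique γ (λ t → walk a t ≟ b) t₀ t₀<γ hit λ t t<γ hit' → walk-injective a t<γ t₀<γ (trans hit' (sym hit))
  ... | no a≢b = sumTo-zero γ λ t _ → χ-no (walk a t ≟ b) λ hit → a≢b (trans (sym (walk-%d a t)) (cong (_% d) hit))

  private
    walk-periodic : ∀ a t → walk a (γ + t) ≡ walk a t
    walk-periodic a t = begin
      (a + J * (γ + t)) % L      ≡⟨ cong (λ z → (a + z) % L) (trans (*-distribˡ-+ J γ t) (+-comm (J * γ) (J * t))) ⟩
      (a + (J * t + J * γ)) % L  ≡⟨ cong (_% L) (+-assoc a (J * t) (J * γ)) ⟨
      (a + J * t + J * γ) % L    ≡⟨ %-remove-+ʳ (a + J * t) L∣Jγ ⟩
      (a + J * t) % L            ∎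

  -- orbits of ⟨a^j⟩ on rows: same block of L rows and same residue mod d
  SameOrbit : ℕ → ℕ → Set
  SameOrbit R r = (R / L ≡ r / L) × (R % d ≡ r % d)

  sameOrbit? : ∀ R r → Dec (SameOrbit R r)
  sameOrbit? R r = (R / L ≟ r / L) ×-dec (R % d ≟ r % d)

  SameOrbit-sym : ∀ {R r} → SameOrbit R r → SameOrbit r R
  SameOrbit-sym (same-block , same-residue) = sym same-block , sym same-residue

  SameOrbit-trans : ∀ {a b c} → SameOrbit a b → SameOrbit b c → SameOrbit a c
  SameOrbit-trans (ab₁ , ab₂) (bc₁ , bc₂) = trans ab₁ bc₁ , trans ab₂ bc₂

  private
    rowShift-/ : ∀ e r → rowShift L e r / L ≡ r / L
    rowShift-/ e r = trans (cong (_/ L) (rowShift≡shift L e r)) (shift-/ L (e %ℕ L) r)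

    rowShift-j*t-% : ∀ t R → rowShift L (j ℤ.* + t) R % L ≡ walk (R % L) t
    rowShift-j*t-% t R = begin
      rowShift L (j ℤ.* + t) R % L                   ≡⟨ cong (_% L) (rowShift≡shift L (j ℤ.* + t) R) ⟩
      shift L ((j ℤ.* + t) %ℕ L) R % L               ≡⟨ shift-% L _ R ⟩
      (R % L + (j ℤ.* + t) %ℕ L) % L                 ≡⟨ cong (λ z → (R % L + z) % L) (%ℕ-distrib-* L j t) ⟩
      (R % L + (J * t) % L) % L                      ≡⟨ %-+ʳ L (R % L) (J * t) ⟩
      walk (R % L) t                                 ∎

    rowShift-j*t-≡ : ∀ t R r → R / L ≡ r / L → walk (R % L) t ≡ r % L → rowShift L (j ℤ.* + t) R ≡ r
    rowShift-j*t-≡ t R r same-block hit = trans (rowShift≡shift L (j ℤ.* + t) R)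
      (sym (≡shift L ((j ℤ.* + t) %ℕ L) R r (sym same-block) (begin
        r % L                           ≡⟨ hit ⟨
        walk (R % L) t                  ≡⟨ %-+ʳ L (R % L) (J * t) ⟨
        (R % L + (J * t) % L) % L       ≡⟨ cong (λ z → (R % L + z) % L) (%ℕ-distrib-* L j t) ⟨
        (R % L + (j ℤ.* + t) %ℕ L) % L  ∎)))

    back⇒walk : ∀ t r R → rowShift L (ℤ.- (j ℤ.* + t)) r ≡ R → walk (R % L) t ≡ r % L
    back⇒walk t r R back = begin
      walk (R % L) t                                                  ≡⟨ rowShift-j*t-% t R ⟨
      rowShift L (j ℤ.* + t) R % L                                    ≡⟨ cong (λ z → rowShift L (j ℤ.* + t) z % L) back ⟨
      rowShift L (j ℤ.* + t) (rowShift L (ℤ.- (j ℤ.* + t)) r) % L     ≡⟨ cong (_% L) (rowShift-inverseʳ L (j ℤ.* + t) r) ⟩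
      r % L                                                           ∎

    walk⇒back : ∀ t r R → R / L ≡ r / L → walk (R % L) t ≡ r % L → rowShift L (ℤ.- (j ℤ.* + t)) r ≡ R
    walk⇒back t r R same-block hit = begin
      rowShift L (ℤ.- (j ℤ.* + t)) r
        ≡⟨ cong (rowShift L (ℤ.- (j ℤ.* + t))) (rowShift-j*t-≡ t R r same-block hit) ⟨
      rowShift L (ℤ.- (j ℤ.* + t)) (rowShift L (j ℤ.* + t) R)
        ≡⟨ rowShift-inverseˡ L (j ℤ.* + t) R ⟩
      R ∎

  count-orbit : ∀ w r R → sumTo (w * γ) (λ t → χ (rowShift L (ℤ.- (j ℤ.* + t)) r ≟ R)) ≡ w * χ (sameOrbit? R r)
  count-orbit w r R = by-block (R / L ≟ r / L)
    where
      back? : ∀ t → Dec (rowShift L (ℤ.- (j ℤ.* + t)) r ≡ R)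
      back? t = rowShift L (ℤ.- (j ℤ.* + t)) r ≟ R
      hit? : ∀ t → Dec (walk (R % L) t ≡ r % L)
      hit? t = walk (R % L) t ≟ r % L
      by-block : Dec (R / L ≡ r / L) → sumTo (w * γ) (λ t → χ (back? t)) ≡ w * χ (sameOrbit? R r)
      by-block (no other-block) = begin
        sumTo (w * γ) (λ t → χ (back? t))  ≡⟨ sumTo-zero (w * γ) (λ t _ → χ-no (back? t) (other-block ∘ same-block t)) ⟩
        0                                  ≡⟨ *-zeroʳ w ⟨
        w * 0                              ≡⟨ cong (_*_ w) (χ-no (sameOrbit? R r) (other-block ∘ proj₁)) ⟨
        w * χ (sameOrbit? R r)             ∎
        where
          same-block : ∀ t → rowShift L (ℤ.- (j ℤ.* + t)) r ≡ R → R / L ≡ r / L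
          same-block t back = trans (cong (_/ L) (sym back)) (rowShift-/ (ℤ.- (j ℤ.* + t)) r)
      by-block (yes same-block) = begin
        sumTo (w * γ) (λ t → χ (back? t))
          ≡⟨ sumTo-cong (w * γ) (λ t _ → χ-⇔ (back? t) (hit? t) (back⇒walk t r R) (walk⇒back t r R same-block)) ⟩
        sumTo (w * γ) (λ t → χ (hit? t))
          ≡⟨ sumTo-periodic w γ (λ t → χ (hit? t)) hit-periodic ⟩
        w * sumTo γ (λ t → χ (hit? t))
          ≡⟨ cong (_*_ w) (count-walk (R % L) (r % L) (m%n<n r L)) ⟩
        w * χ (R % L % d ≟ r % L % d)
          ≡⟨ cong (_*_ w) (χ-⇔ (R % L % d ≟ r % L % d) (sameOrbit? R r) residue⇒same same⇒residue) ⟩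
        w * χ (sameOrbit? R r) ∎
        where
          hit-periodic : ∀ t → χ (hit? (γ + t)) ≡ χ (hit? t)
          hit-periodic t = χ-⇔ (hit? (γ + t)) (hit? t) (trans (sym (walk-periodic (R % L) t))) (trans (walk-periodic (R % L) t))
          residue⇒same : R % L % d ≡ r % L % d → SameOrbit R r
          residue⇒same eq = same-block , trans (sym (%L%d R)) (trans eq (%L%d r))
          same⇒residue : SameOrbit R r → R % L % d ≡ r % L % d
          same⇒residue (_ , same-residue) = trans (%L%d R) (trans same-residue (sym (%L%d r)))

  -- an aligned row i is the first of its orbit i, i + d, …, i + (γ - 1) d
  Aligned : ℕ → Set
  Aligned i = i % L < d

  aligned? : ∀ i → Dec (Aligned i)
  aligned? i = i % L <? d

  ¬aligned⇒d≤ : ∀ i → ¬ Aligned i → d ≤ i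
  ¬aligned⇒d≤ i ¬aligned = ≤-trans (≮⇒≥ ¬aligned) (m%n≤m i L)

  aligned-+L : ∀ i → Aligned i → Aligned (i + L)
  aligned-+L i aligned = subst (_< d) (sym ([m+n]%n≡m%n i L)) aligned

  progression⇒SameOrbit : ∀ i₀ s → Aligned i₀ → s < γ → SameOrbit (i₀ + s * d) i₀
  progression⇒SameOrbit i₀ s aligned s<γ =
    trans (cong (_/ L) i₀+sd≡) ([qL+b]/L≡q L (i₀ / L) _ in-block) , [m+kn]%n≡m%n i₀ s d
    where
      i₀+sd≡ : i₀ + s * d ≡ i₀ / L * L + (i₀ % L + s * d)
      i₀+sd≡ = trans (cong (_+ s * d) (m≡[m/n]*n+m%n L i₀)) (+-assoc _ (i₀ % L) (s * d))
      in-block : i₀ % L + s * d < L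
      in-block = subst (i₀ % L + s * d <_) γ*d≡L (≤-trans (+-monoˡ-< (s * d) aligned) (*-monoˡ-≤ d s<γ))

  SameOrbit⇒progression : ∀ i₀ R → Aligned i₀ → SameOrbit R i₀ → ∃ λ s → s < γ × R ≡ i₀ + s * d
  SameOrbit⇒progression i₀ R aligned (same-block , same-residue) = s , /d<γ (R % L) (m%n<n R L) , (begin
    R                                    ≡⟨ m≡[m/n]*n+m%n L R ⟩
    R / L * L + R % L                    ≡⟨ cong₂ _+_ (cong (_* L) same-block) R%L≡ ⟩
    i₀ / L * L + (s * d + i₀ % L)        ≡⟨ cong (_+_ (i₀ / L * L)) (+-comm (s * d) (i₀ % L)) ⟩
    i₀ / L * L + (i₀ % L + s * d)        ≡⟨ +-assoc _ (i₀ % L) (s * d) ⟨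
    i₀ / L * L + i₀ % L + s * d          ≡⟨ cong (_+ s * d) (m≡[m/n]*n+m%n L i₀) ⟨
    i₀ + s * d                           ∎)
    where
      s = (R % L) / d
      i₀%L≡i₀%d : i₀ % L ≡ i₀ % d
      i₀%L≡i₀%d = trans (sym (m<n⇒m%n≡m aligned)) (%L%d i₀)
      R%L≡ : R % L ≡ s * d + i₀ % L
      R%L≡ = trans (m≡[m/n]*n+m%n d (R % L)) (cong (_+_ (s * d)) (trans (%L%d R) (trans same-residue (sym i₀%L≡i₀%d))))

  firstInOrbit : ℕ → ℕ
  firstInOrbit r = (r / L) * L + r % d

  firstInOrbit-aligned : ∀ r → Aligned (firstInOrbit r)
  firstInOrbit-aligned r = subst (_< d) (sym ([qL+b]%L≡b L (r / L) (r % d) (≤-trans (m%n<n r d) d≤L))) (m%n<n r d)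

  firstInOrbit-SameOrbit : ∀ r → SameOrbit (firstInOrbit r) r
  firstInOrbit-SameOrbit r = [qL+b]/L≡q L (r / L) (r % d) (≤-trans (m%n<n r d) d≤L) , (begin
    (r / L * L + r % d) % d
      ≡⟨ cong (_% d) (+-comm (r / L * L) (r % d)) ⟩
    (r % d + r / L * L) % d
      ≡⟨ cong (λ z → (r % d + z) % d) (trans (cong (_*_ (r / L)) (sym γ*d≡L)) (sym (*-assoc (r / L) γ d))) ⟩
    (r % d + r / L * γ * d) % d
      ≡⟨ [m+kn]%n≡m%n (r % d) (r / L * γ) d ⟩
    r % d % d
      ≡⟨ m%n%n≡m%n r d ⟩
    r % d ∎)

  indexInOrbit : ℕ → ℕ
  indexInOrbit r = (r % L) / d

  indexInOrbit<γ : ∀ r → indexInOrbit r < γ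
  indexInOrbit<γ r = /d<γ (r % L) (m%n<n r L)

  firstInOrbit+indexInOrbit*d : ∀ r → firstInOrbit r + indexInOrbit r * d ≡ r
  firstInOrbit+indexInOrbit*d r = begin
    r / L * L + r % d + indexInOrbit r * d      ≡⟨ +-assoc (r / L * L) (r % d) _ ⟩
    r / L * L + (r % d + indexInOrbit r * d)    ≡⟨ cong (_+_ (r / L * L)) (+-comm (r % d) _) ⟩
    r / L * L + (indexInOrbit r * d + r % d)    ≡⟨ cong (λ z → r / L * L + (indexInOrbit r * d + z)) (%L%d r) ⟨
    r / L * L + (indexInOrbit r * d + r % L % d) ≡⟨ cong (_+_ (r / L * L)) (m≡[m/n]*n+m%n d (r % L)) ⟨
    r / L * L + r % L                          ≡⟨ m≡[m/n]*n+m%n L r ⟨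
    r                                          ∎

module ListFacts where

  open import Data.Nat
  open import Data.Nat.Properties
  open import Data.Fin as F using (Fin; toℕ)
  open import Data.List as List using (List; []; _∷_; _++_; length; lookup; filter; map; concatMap; concat; deduplicate; tabulate; allFin)
  open import Data.List.Properties using (length-++; filter-++; map-tabulate)
  open import Data.List.Relation.Unary.All as All using (All; []; _∷_)
  import Data.List.Relation.Unary.All.Properties as All
  open import Data.List.Relation.Unary.AllPairs as AllPairs using (AllPairs; []; _∷_)
  import Data.List.Relation.Unary.AllPairs.Properties as AllPairs
  open import Data.List.Relation.Unary.Any using (here; there)
  open import Data.List.Relation.Unary.Linked using (Linked; []; _∷_)
  open import Data.List.Membership.Propositional using (_∈_)
  open import Data.List.Membership.Propositional.Properties using (∈-deduplicate⁻)
  open import Data.Product using (∃; _×_; _,_)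
  open import Data.Empty using (⊥-elim)
  open import Relation.Nullary using (yes; no; ¬?)
  open import Relation.Unary using (Decidable)
  open import Relation.Binary.PropositionalEquality
  open import Function using (_∘_; id)
  open import Defs using (count; at; IsPartition)
  open FiniteSums

  module _ {A : Set} {P : A → Set} (P? : Decidable P) where

    count-∷ : ∀ x xs → count P? (x ∷ xs) ≡ χ (P? x) + count P? xs
    count-∷ x xs with P? x
    ... | yes _ = refl
    ... | no _ = refl

    count-++ : ∀ xs ys → count P? (xs ++ ys) ≡ count P? xs + count P? ys
    count-++ xs ys = trans (cong length (filter-++ P? xs ys)) (length-++ (filter P? xs))

    count-tabulate : ∀ N (f : Fin N → A) → count P? (tabulate f) ≡ ∑[ i < N ] χ (P? (f i))
    count-tabulate zero f = refl
    count-tabulate (suc N) f = trans (count-∷ (f F.zero) _) (cong (χ (P? (f F.zero)) +_) (count-tabulate N (f ∘ F.suc)))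

    count-map-allFin : ∀ N (f : Fin N → A) → count P? (map f (allFin N)) ≡ ∑[ i < N ] χ (P? (f i))
    count-map-allFin N f = trans (cong (count P?) (map-tabulate id f)) (count-tabulate N f)

    count-concatMap-allFin : ∀ N (f : Fin N → List A) → count P? (concatMap f (allFin N)) ≡ ∑[ i < N ] count P? (f i)
    count-concatMap-allFin zero f = refl
    count-concatMap-allFin (suc N) f = begin
      count P? (f F.zero ++ concat (map f (tabulate F.suc)))
        ≡⟨ count-++ (f F.zero) _ ⟩
      count P? (f F.zero) + count P? (concat (map f (tabulate F.suc)))
        ≡⟨ cong (λ xs → count P? (f F.zero) + count P? (concat xs))
                (trans (map-tabulate F.suc f) (sym (map-tabulate id (f ∘ F.suc)))) ⟩
      count P? (f F.zero) + count P? (concatMap (f ∘ F.suc) (allFin N))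
        ≡⟨ cong (count P? (f F.zero) +_) (count-concatMap-allFin N (f ∘ F.suc)) ⟩
      ∑[ i < suc N ] count P? (f i) ∎
      where open ≡-Reasoning

  AllPairs-weaken : ∀ {A : Set} {P : A → Set} {R R' : A → A → Set} → (∀ {x y} → P x → P y → R x y → R' x y)
                  → ∀ {xs} → All P xs → AllPairs R xs → AllPairs R' xs
  AllPairs-weaken f [] [] = []
  AllPairs-weaken f (px ∷ pxs) (rx ∷ rxs) = All.zipWith (λ (py , r) → f px py r) (pxs , rx) ∷ AllPairs-weaken f pxs rxs

  deduplicate-sorted : ∀ {xs : List ℕ} → AllPairs _≤_ xs → AllPairs _<_ (deduplicate _≟_ xs)
  deduplicate-sorted {[]} [] = []
  deduplicate-sorted {x ∷ xs} (x≤xs ∷ xs-sorted) =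
    All.zipWith (λ (x≤y , x≢y) → ≤∧≢⇒< x≤y x≢y)
                (All.filter⁺ (¬? ∘ (x ≟_)) x≤rest , All.all-filter (¬? ∘ (x ≟_)) (deduplicate _≟_ xs))
    ∷ AllPairs.filter⁺ (¬? ∘ (x ≟_)) (deduplicate-sorted xs-sorted)
    where
      x≤rest : All (x ≤_) (deduplicate _≟_ xs)
      x≤rest = All.tabulate (λ y∈ → All.lookup x≤xs (∈-deduplicate⁻ _≟_ xs y∈))

  strictlySorted-≡ : ∀ {xs ys : List ℕ} → AllPairs _<_ xs → AllPairs _<_ ys
                   → (∀ {z} → z ∈ xs → z ∈ ys) → (∀ {z} → z ∈ ys → z ∈ xs) → xs ≡ ys
  strictlySorted-≡ {[]} {[]} _ _ _ _ = refl
  strictlySorted-≡ {[]} {y ∷ ys} _ _ _ ys⊆xs with ys⊆xs (here refl)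
  ... | ()
  strictlySorted-≡ {x ∷ xs} {[]} _ _ xs⊆ys _ with xs⊆ys (here refl)
  ... | ()
  strictlySorted-≡ {x ∷ xs} {y ∷ ys} (x<xs ∷ xs<) (y<ys ∷ ys<) xs⊆ys ys⊆xs =
    cong₂ _∷_ x≡y (strictlySorted-≡ xs< ys< tail⊆ tail⊇)
    where
      x≡y : x ≡ y
      x≡y with xs⊆ys (here refl) | ys⊆xs (here refl)
      ... | here x≡y | _ = x≡y
      ... | there _ | here y≡x = sym y≡x
      ... | there x∈ys | there y∈xs = ⊥-elim (<-asym (All.lookup y<ys x∈ys) (All.lookup x<xs y∈xs))
      tail⊆ : ∀ {z} → z ∈ xs → z ∈ ys
      tail⊆ z∈ with xs⊆ys (there z∈)
      ... | here z≡y = ⊥-elim (<-irrefl (sym (trans z≡y (sym x≡y))) (All.lookup x<xs z∈))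
      ... | there z∈ys = z∈ys
      tail⊇ : ∀ {z} → z ∈ ys → z ∈ xs
      tail⊇ z∈ with ys⊆xs (there z∈)
      ... | here z≡x = ⊥-elim (<-irrefl (sym (trans z≡x x≡y)) (All.lookup y<ys z∈))
      ... | there z∈xs = z∈xs

  progression : ℕ → ℕ → ℕ → List ℕ
  progression a δ zero = []
  progression a δ (suc n) = a ∷ progression (a + δ) δ n

  ∈-progression⁻ : ∀ a δ n {z} → z ∈ progression a δ n → ∃ λ s → s < n × z ≡ a + s * δ
  ∈-progression⁻ a δ (suc n) (here z≡a) = 0 , z<s , trans z≡a (sym (+-identityʳ a))
  ∈-progression⁻ a δ (suc n) (there z∈) with ∈-progression⁻ (a + δ) δ n z∈
  ... | s , s<n , z≡ = suc s , s<s s<n , trans z≡ (+-assoc a δ (s * δ))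

  ∈-progression⁺ : ∀ a δ n s → s < n → a + s * δ ∈ progression a δ n
  ∈-progression⁺ a δ (suc n) zero _ = here (+-identityʳ a)
  ∈-progression⁺ a δ (suc n) (suc s) (s<s s<n) =
    there (subst (_∈ progression (a + δ) δ n) (+-assoc a δ (s * δ)) (∈-progression⁺ (a + δ) δ n s s<n))

  progression-sorted : ∀ a δ n → 0 < δ → AllPairs _<_ (progression a δ n)
  progression-sorted a δ zero _ = []
  progression-sorted a δ (suc n) δ>0 = All.tabulate a<later ∷ progression-sorted (a + δ) δ n δ>0
    where
      a<later : ∀ {z} → z ∈ progression (a + δ) δ n → a < z
      a<later z∈ with ∈-progression⁻ (a + δ) δ n z∈
      ... | s , _ , refl = <-≤-trans (m<m+n a δ>0) (m≤m+n (a + δ) (s * δ))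

  at-progression : ∀ a δ n v → v < n → at (progression a δ n) v ≡ a + v * δ
  at-progression a δ (suc n) zero _ = sym (+-identityʳ a)
  at-progression a δ (suc n) (suc v) (s<s v<n) = trans (at-progression (a + δ) δ n v v<n) (+-assoc a δ (v * δ))

  at-progression-injective : ∀ a δ n {v v'} → 0 < δ → v < n → v' < n
                           → at (progression a δ n) v ≡ at (progression a δ n) v' → v ≡ v'
  at-progression-injective a δ n {v} {v'} δ>0 v<n v'<n eq = *-cancelʳ-≡ v v' δ {{>-nonZero δ>0}}
    (+-cancelˡ-≡ a _ _ (trans (sym (at-progression a δ n v v<n)) (trans eq (at-progression a δ n v' v'<n))))

  lookup≡at : ∀ (xs : List ℕ) i → lookup xs i ≡ at xs (toℕ i)
  lookup≡at (x ∷ xs) F.zero = refl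
  lookup≡at (x ∷ xs) (F.suc i) = lookup≡at xs i

  at-≥length : ∀ (xs : List ℕ) i → length xs ≤ i → at xs i ≡ 0
  at-≥length [] i _ = refl
  at-≥length (x ∷ xs) (suc i) (s≤s le) = at-≥length xs i le

  at>0⇒<length : ∀ (xs : List ℕ) i → 0 < at xs i → i < length xs
  at>0⇒<length xs i at>0 with i <? length xs
  ... | yes i<length = i<length
  ... | no i≮length = ⊥-elim (<-irrefl (sym (at-≥length xs i (≮⇒≥ i≮length))) at>0)

  at-antitone : ∀ (xs : List ℕ) → Linked _≥_ xs → ∀ {i i'} → i ≤ i' → at xs i' ≤ at xs i
  at-antitone [] _ _ = z≤n
  at-antitone (x ∷ xs) decreasing {zero} {i'} _ = ≤head x xs decreasing i'
    where
      ≤head : ∀ x xs → Linked _≥_ (x ∷ xs) → ∀ i → at (x ∷ xs) i ≤ x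
      ≤head x xs _ zero = ≤-refl
      ≤head x [] _ (suc i) = z≤n
      ≤head x (y ∷ xs) (x≥y ∷ decreasing) (suc i) = ≤-trans (≤head y xs decreasing i) x≥y
  at-antitone (x ∷ []) _ {suc i} {suc i'} _ = z≤n
  at-antitone (x ∷ y ∷ xs) (_ ∷ decreasing) {suc i} {suc i'} (s≤s i≤i') = at-antitone (y ∷ xs) decreasing i≤i'

  partition-head>0 : ∀ {p k} → IsPartition p k → 0 < k → 0 < at p 0
  partition-head>0 {[]} (_ , _ , refl) ()
  partition-head>0 {x ∷ xs} (_ , x>0 ∷ _ , _) _ = x>0

module Numbering where

  open import Data.Nat
  open import Data.Nat.Properties
  open import Data.Nat.ListAction using (sum)
  open import Data.Fin as F using (Fin; toℕ; fromℕ<; _↑ˡ_; _↑ʳ_; splitAt; cast; inject₁)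
  open import Data.Fin.Properties
    using (splitAt-↑ˡ; splitAt-↑ʳ; splitAt⁻¹-↑ˡ; splitAt⁻¹-↑ʳ; toℕ-fromℕ<; toℕ-injective; toℕ-inject₁; toℕ-fromℕ; cast-is-id; toℕ<n)
  open import Data.List as List using ([]; _∷_; length; lookup)
  open import Data.Sum using (inj₁; inj₂)
  open import Data.Product using (_,_; proj₁; proj₂)
  open import Data.Empty using (⊥-elim)
  open import Relation.Nullary.Decidable using (recompute)
  open import Relation.Binary.PropositionalEquality
  open import Function using (_∘_)
  open import Defs using (locate; σinv; cycPred)
  open FiniteSums

  n∸1<n : ∀ n → .(0 < n) → n ∸ 1 < n
  n∸1<n (suc n) _ = n<1+n n

  -- the 0-based number n_{ρ,k+1} + t
  number : ∀ ps (k : Fin (length ps)) t → .(t < lookup ps k) → Fin (sum ps)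
  number (p ∷ ps) F.zero t t<p = fromℕ< t<p ↑ˡ sum ps
  number (p ∷ ps) (F.suc k) t t<ρk = p ↑ʳ number ps k t t<ρk

  private
    locate-↑ˡ : ∀ p ps (i : Fin p) → locate (p ∷ ps) (i ↑ˡ sum ps) ≡ (F.zero , toℕ i)
    locate-↑ˡ p ps i rewrite splitAt-↑ˡ p i (sum ps) = refl

    locate-↑ʳ : ∀ p ps (y : Fin (sum ps)) → locate (p ∷ ps) (p ↑ʳ y) ≡ (F.suc (proj₁ (locate ps y)) , proj₂ (locate ps y))
    locate-↑ʳ p ps y rewrite splitAt-↑ʳ p (sum ps) y = refl

  locate-number : ∀ ps k t .(t<ρk : t < lookup ps k) → locate ps (number ps k t t<ρk) ≡ (k , t)
  locate-number (p ∷ ps) F.zero t t<p = trans (locate-↑ˡ p ps (fromℕ< t<p)) (cong (F.zero ,_) (toℕ-fromℕ< t<p))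
  locate-number (p ∷ ps) (F.suc k) t t<ρk =
    trans (locate-↑ʳ p ps (number ps k t t<ρk)) (cong (λ z → F.suc (proj₁ z) , proj₂ z) (locate-number ps k t t<ρk))

  locate-< : ∀ ps x → proj₂ (locate ps x) < lookup ps (proj₁ (locate ps x))
  locate-< (p ∷ ps) x with splitAt p x
  ... | inj₁ a = toℕ<n a
  ... | inj₂ b = locate-< ps b

  number-locate : ∀ ps x .(t<ρk : proj₂ (locate ps x) < lookup ps (proj₁ (locate ps x)))
                → number ps (proj₁ (locate ps x)) (proj₂ (locate ps x)) t<ρk ≡ x
  number-locate (p ∷ ps) x t<ρk with splitAt p x in eq
  ... | inj₁ a = trans (cong (_↑ˡ sum ps) (toℕ-injective (toℕ-fromℕ< (toℕ<n a)))) (splitAt⁻¹-↑ˡ eq)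
  ... | inj₂ b = trans (cong (p ↑ʳ_) (number-locate ps b t<ρk)) (splitAt⁻¹-↑ʳ eq)

  σinv-number-suc : ∀ ps k t .(t+1<ρk : suc t < lookup ps k)
                  → σinv ps (number ps k (suc t) t+1<ρk) ≡ number ps k t (<-trans (n<1+n t) t+1<ρk)
  σinv-number-suc (p ∷ ps) F.zero t t+1<p rewrite splitAt-↑ˡ p (fromℕ< t+1<p) (sum ps) =
    cong (_↑ˡ sum ps) (toℕ-injective (predecessor p t+1<p))
    where
      predecessor : ∀ p .(t+1<p : suc t < p)
                  → toℕ (cycPred {p} (fromℕ< t+1<p)) ≡ toℕ (fromℕ< {t} {p} (<-trans (n<1+n t) t+1<p))
      predecessor (suc zero) t+1<1 = ⊥-elim (n≮0 (s<s⁻¹ (recompute (suc t <? 1) t+1<1)))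
      predecessor (suc (suc p)) t+1<p = begin
        toℕ (inject₁ (fromℕ< (s<s⁻¹ t+1<p)))  ≡⟨ toℕ-inject₁ (fromℕ< {t} {suc p} (s<s⁻¹ t+1<p)) ⟩
        toℕ (fromℕ< {t} {suc p} (s<s⁻¹ t+1<p))  ≡⟨ toℕ-fromℕ< (s<s⁻¹ t+1<p) ⟩
        t                                      ≡⟨ toℕ-fromℕ< (<-trans (n<1+n t) t+1<p) ⟨
        toℕ (fromℕ< (<-trans (n<1+n t) t+1<p))  ∎
        where open ≡-Reasoning
  σinv-number-suc (p ∷ ps) (F.suc k) t t+1<ρk rewrite splitAt-↑ʳ p (sum ps) (number ps k (suc t) t+1<ρk) =
    cong (p ↑ʳ_) (σinv-number-suc ps k t t+1<ρk)

  σinv-number-zero : ∀ ps k .(0<ρk : 0 < lookup ps k)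
                   → σinv ps (number ps k 0 0<ρk) ≡ number ps k (lookup ps k ∸ 1) (n∸1<n (lookup ps k) 0<ρk)
  σinv-number-zero (p ∷ ps) F.zero 0<p rewrite splitAt-↑ˡ p (fromℕ< 0<p) (sum ps) =
    cong (_↑ˡ sum ps) (toℕ-injective (last p 0<p))
    where
      last : ∀ p .(0<p : 0 < p) → toℕ (cycPred {p} (fromℕ< 0<p)) ≡ toℕ (fromℕ< {p ∸ 1} {p} (n∸1<n p 0<p))
      last (suc p) _ = trans (toℕ-fromℕ p) (sym (toℕ-fromℕ< (n<1+n p)))
  σinv-number-zero (p ∷ ps) (F.suc k) 0<ρk rewrite splitAt-↑ʳ p (sum ps) (number ps k 0 0<ρk) =
    cong (p ↑ʳ_) (σinv-number-zero ps k 0<ρk)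

  ∑-locate : ∀ ps (g : Fin (length ps) → ℕ → ℕ)
           → ∑[ x < sum ps ] g (proj₁ (locate ps x)) (proj₂ (locate ps x)) ≡ ∑[ k < length ps ] sumTo (lookup ps k) (g k)
  ∑-locate [] g = refl
  ∑-locate (p ∷ ps) g = trans (∑-↑ p (sum ps) _) (cong₂ _+_
    (sum-cong-≗ λ i → cong (λ z → g (proj₁ z) (proj₂ z)) (locate-↑ˡ p ps i))
    (trans (sum-cong-≗ λ y → cong (λ z → g (proj₁ z) (proj₂ z)) (locate-↑ʳ p ps y)) (∑-locate ps (g ∘ F.suc))))

  ∑-cast : ∀ {a b} (a≡b : a ≡ b) (f : Fin b → ℕ) → ∑[ x < b ] f x ≡ ∑[ x < a ] f (cast a≡b x)
  ∑-cast refl f = sum-cong-≗ λ x → cong f (sym (cast-is-id refl x))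

module Filling where

  open import Data.Nat
  open import Data.Nat.Properties
  open import Data.Fin as F using (Fin; toℕ)
  open import Data.Fin.Properties as FP using (toℕ-injective)
  open import Data.Product using (_×_; _,_; proj₁; proj₂)
  open import Data.Empty using (⊥-elim)
  open import Relation.Nullary using (¬_; yes; no)
  open import Relation.Nullary.Decidable using (recompute; _×-dec_)
  open import Relation.Binary.Definitions using (tri<; tri≈; tri>)
  open import Relation.Binary.PropositionalEquality
  open import Function using (_∘_)
  open FiniteSums

  prefix : ∀ K (F : Fin K → ℕ) → Fin K → ℕ
  prefix (suc K) F F.zero = 0
  prefix (suc K) F (F.suc k) = F F.zero + prefix K (F ∘ F.suc) k

  prefix-cong : ∀ K {F G : Fin K → ℕ} → (∀ k → F k ≡ G k) → ∀ k → prefix K F k ≡ prefix K G k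
  prefix-cong (suc K) F≗G F.zero = refl
  prefix-cong (suc K) F≗G (F.suc k) = cong₂ _+_ (F≗G F.zero) (prefix-cong K (F≗G ∘ F.suc) k)

  prefix+≤∑ : ∀ K F k → prefix K F k + F k ≤ ∑[ i < K ] F i
  prefix+≤∑ (suc K) F F.zero = m≤m+n (F F.zero) _
  prefix+≤∑ (suc K) F (F.suc k) =
    subst (_≤ ∑[ i < suc K ] F i) (sym (+-assoc (F F.zero) _ _)) (+-monoʳ-≤ (F F.zero) (prefix+≤∑ K (F ∘ F.suc) k))

  private
    prefix+≤prefix : ∀ K F (x y : Fin K) → toℕ x < toℕ y → prefix K F x + F x ≤ prefix K F y
    prefix+≤prefix (suc K) F F.zero (F.suc y) _ = m≤m+n (F F.zero) _
    prefix+≤prefix (suc K) F (F.suc x) (F.suc y) (s<s x<y) =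
      subst (_≤ F F.zero + prefix K (F ∘ F.suc) y) (sym (+-assoc (F F.zero) _ _))
            (+-monoʳ-≤ (F F.zero) (prefix+≤prefix K (F ∘ F.suc) x y x<y))

    ∸-<-split : ∀ {c a b} → ¬ c < a → c < a + b → c ∸ a < b
    ∸-<-split {c} {a} {b} c≮a c<a+b = +-cancelˡ-< a _ _ (subst (_< a + b) (sym (m+[n∸m]≡n (≮⇒≥ c≮a))) c<a+b)

  -- the value at position c when F k copies of each k are written in increasing order
  fill : ∀ K (F : Fin K → ℕ) c → .(c < ∑[ i < K ] F i) → Fin K
  fill zero F c c<0 = ⊥-elim (n≮0 (recompute (c <? 0) c<0))
  fill (suc K) F c c<∑ with c <? F F.zero
  ... | yes _ = F.zero
  ... | no c≮F₀ = F.suc (fill K (F ∘ F.suc) (c ∸ F F.zero) (∸-<-split c≮F₀ c<∑))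

  fill⇒ : ∀ K F c .(c<∑ : c < ∑[ i < K ] F i) k → fill K F c c<∑ ≡ k → prefix K F k ≤ c × c < prefix K F k + F k
  fill⇒ zero F c c<0 k _ = ⊥-elim (n≮0 (recompute (c <? 0) c<0))
  fill⇒ (suc K) F c c<∑ k eq with c <? F F.zero
  fill⇒ (suc K) F c c<∑ F.zero eq | yes c<F₀ = z≤n , c<F₀
  fill⇒ (suc K) F c c<∑ F.zero () | no _
  fill⇒ (suc K) F c c<∑ (F.suc k) eq | no c≮F₀
    with lower , upper ← fill⇒ K (F ∘ F.suc) (c ∸ F F.zero) (∸-<-split c≮F₀ c<∑) k (FP.suc-injective eq) =
      subst (F F.zero + prefix K (F ∘ F.suc) k ≤_) (m+[n∸m]≡n F₀≤c) (+-monoʳ-≤ (F F.zero) lower)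
    , subst (_< F F.zero + prefix K (F ∘ F.suc) k + F (F.suc k)) (m+[n∸m]≡n F₀≤c)
        (subst (F F.zero + (c ∸ F F.zero) <_) (sym (+-assoc (F F.zero) _ _)) (+-monoʳ-< (F F.zero) upper))
    where F₀≤c = ≮⇒≥ c≮F₀

  fill⇐ : ∀ K F c .(c<∑ : c < ∑[ i < K ] F i) k → prefix K F k ≤ c → c < prefix K F k + F k → fill K F c c<∑ ≡ k
  fill⇐ zero F c c<0 k _ _ = ⊥-elim (n≮0 (recompute (c <? 0) c<0))
  fill⇐ (suc K) F c c<∑ k lower upper with c <? F F.zero
  fill⇐ (suc K) F c c<∑ F.zero lower upper | yes _ = refl
  fill⇐ (suc K) F c c<∑ (F.suc k) lower upper | yes c<F₀ = ⊥-elim (<⇒≱ c<F₀ (≤-trans (m≤m+n (F F.zero) _) lower))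
  fill⇐ (suc K) F c c<∑ F.zero lower upper | no c≮F₀ = ⊥-elim (c≮F₀ upper)
  fill⇐ (suc K) F c c<∑ (F.suc k) lower upper | no c≮F₀ =
    cong F.suc (fill⇐ K (F ∘ F.suc) (c ∸ F F.zero) (∸-<-split c≮F₀ c<∑) k
    (subst (_≤ c ∸ F F.zero) (m+n∸m≡n (F F.zero) _) (∸-monoˡ-≤ (F F.zero) lower))
    (∸-<-split c≮F₀ (subst (c <_) (+-assoc (F F.zero) _ _) upper)))

  fill-mono : ∀ K F a b .(a<∑ : a < ∑[ i < K ] F i) .(b<∑ : b < ∑[ i < K ] F i)
            → a ≤ b → toℕ (fill K F a a<∑) ≤ toℕ (fill K F b b<∑)
  fill-mono K F a b a<∑ b<∑ a≤b with fill K F a a<∑ in fa | fill K F b b<∑ in fb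
  ... | ka | kb with <-cmp (toℕ ka) (toℕ kb)
  ... | tri< ka<kb _ _ = <⇒≤ ka<kb
  ... | tri≈ _ ka≡kb _ = ≤-reflexive ka≡kb
  ... | tri> _ _ kb<ka = ⊥-elim (<⇒≱ (≤-trans (proj₂ (fill⇒ K F b b<∑ kb fb)) (prefix+≤prefix K F kb ka kb<ka))
                                      (≤-trans (proj₁ (fill⇒ K F a a<∑ ka fa)) a≤b))

  count-fill : ∀ K F L → L ≡ ∑[ i < K ] F i → .(bound : ∀ (c : Fin L) → toℕ c < ∑[ i < K ] F i)
             → ∀ k → ∑[ c < L ] χ (fill K F (toℕ c) (bound c) F.≟ k) ≡ F k
  count-fill K F L L≡∑ bound k = begin
    ∑[ c < L ] χ (fill K F (toℕ c) (bound c) F.≟ k)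
      ≡⟨ sum-cong-≗ {L} (λ c → χ-⇔ (_ F.≟ k) (in-block? (toℕ c)) (fill⇒ K F _ (bound c) k)
                                   (λ (lower , upper) → fill⇐ K F _ (bound c) k lower upper)) ⟩
    ∑[ c < L ] χ (in-block? (toℕ c))
      ≡⟨ sum-cong-≗ {L} (λ c → χ-× (prefix K F k ≤? toℕ c) (toℕ c <? prefix K F k + F k)) ⟩
    sumTo L (λ c → χ (prefix K F k ≤? c) * χ (c <? prefix K F k + F k))
      ≡⟨ sumTo-interval L (prefix K F k) (F k) (subst (prefix K F k + F k ≤_) (sym L≡∑) (prefix+≤∑ K F k)) ⟩
    F k ∎
    where
      open ≡-Reasoning
      in-block? = λ c → (prefix K F k ≤? c) ×-dec (c <? prefix K F k + F k)

  monotone-≡ : ∀ K L (g₁ g₂ : Fin L → Fin K)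
    → (∀ a b → toℕ a ≤ toℕ b → toℕ (g₁ a) ≤ toℕ (g₁ b))
    → (∀ a b → toℕ a ≤ toℕ b → toℕ (g₂ a) ≤ toℕ (g₂ b))
    → (∀ k → ∑[ c < L ] χ (g₁ c F.≟ k) ≡ ∑[ c < L ] χ (g₂ c F.≟ k))
    → ∀ c → g₁ c ≡ g₂ c
  monotone-≡ K (suc L) g₁ g₂ mono₁ mono₂ same-fibres = same
    where
      first-not-smaller : ∀ (h₁ h₂ : Fin (suc L) → Fin K)
                        → (∀ a b → toℕ a ≤ toℕ b → toℕ (h₂ a) ≤ toℕ (h₂ b))
                        → (∀ k → ∑[ c < suc L ] χ (h₁ c F.≟ k) ≡ ∑[ c < suc L ] χ (h₂ c F.≟ k))
                        → ¬ toℕ (h₁ F.zero) < toℕ (h₂ F.zero)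
      first-not-smaller h₁ h₂ mono same h₁₀<h₂₀ = 1≰0 (begin
        1
          ≡⟨ χ-yes (h₁ F.zero F.≟ h₁ F.zero) refl ⟨
        χ (h₁ F.zero F.≟ h₁ F.zero)
          ≤⟨ ≤-∑ (suc L) (λ c → χ (h₁ c F.≟ h₁ F.zero)) F.zero ⟩
        ∑[ c < suc L ] χ (h₁ c F.≟ h₁ F.zero)
          ≡⟨ same (h₁ F.zero) ⟩
        ∑[ c < suc L ] χ (h₂ c F.≟ h₁ F.zero)
          ≡⟨ ∑-zero (suc L) (λ c → χ-no (h₂ c F.≟ h₁ F.zero) λ h₂c≡h₁₀ →
            <⇒≱ h₁₀<h₂₀ (subst (λ z → toℕ (h₂ F.zero) ≤ toℕ z) h₂c≡h₁₀ (mono F.zero c z≤n))) ⟩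
        0 ∎)
        where
          open ≤-Reasoning
          1≰0 : ¬ 1 ≤ 0
          1≰0 ()
      same₀ : g₁ F.zero ≡ g₂ F.zero
      same₀ with <-cmp (toℕ (g₁ F.zero)) (toℕ (g₂ F.zero))
      ... | tri< lt _ _ = ⊥-elim (first-not-smaller g₁ g₂ mono₂ same-fibres lt)
      ... | tri≈ _ eq _ = toℕ-injective eq
      ... | tri> _ _ gt = ⊥-elim (first-not-smaller g₂ g₁ mono₁ (sym ∘ same-fibres) gt)
      same : ∀ c → g₁ c ≡ g₂ c
      same F.zero = same₀
      same (F.suc c) = monotone-≡ K L (g₁ ∘ F.suc) (g₂ ∘ F.suc)
        (λ a b → mono₁ (F.suc a) (F.suc b) ∘ s≤s) (λ a b → mono₂ (F.suc a) (F.suc b) ∘ s≤s)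
        (λ k → +-cancelˡ-≡ (χ (g₁ F.zero F.≟ k)) _ _ (trans (same-fibres k) (cong (λ z → χ (z F.≟ k) + _) (sym same₀))))
        c

module Tabloids {n : ℕ} (μ : Fin n → List ℕ) (l γ : Fin n → ℕ) (ρ : List ℕ) (j : ℤ) (m : ℕ) (ρm : sum ρ ≡ m)
                (l>0 : ∀ h → 0 < l h) (μ-decreasing : ∀ h → Linked _≥_ (μ h)) (μ-nonempty : ∀ h → 0 < at (μ h) 0)
                (ρ-positive : All (0 <_) ρ) (γ-order : ∀ h → IsOrderOfPower (l h) (μ h) j (γ h)) where

  open import Data.Nat
  open import Data.Nat.Properties
  open import Data.Nat.Divisibility using (_∣_)
  open import Data.Nat.Induction using (<-rec)
  open import Data.Integer as ℤ using ()
  open import Data.Integer.Properties as ℤP using (pos-+)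
  open import Data.Integer.Solver using (module +-*-Solver)
  open import Data.Fin as F using (toℕ; fromℕ<; cast)
  open import Data.Fin.Properties using (toℕ-injective; toℕ<n; toℕ-fromℕ<; fromℕ<-toℕ; cast-involutive)
  open import Data.List as List using (length; lookup; map; filter; concatMap; allFin; deduplicate)
  open import Data.List.Properties using (filter-≐)
  import Data.List.Relation.Unary.All as All
  import Data.List.Relation.Unary.All.Properties as All
  open import Data.List.Relation.Unary.AllPairs using (AllPairs)
  import Data.List.Relation.Unary.AllPairs.Properties as AllPairs
  open import Data.List.Membership.Propositional using (_∈_; lose)
  open import Data.List.Membership.Propositional.Properties
    using (∈-deduplicate⁻; ∈-deduplicate⁺; ∈-filter⁻; ∈-filter⁺; ∈-map⁻; ∈-map⁺; ∈-concatMap⁺; ∈-allFin; ∈-lookup)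
  open import Data.Product using (Σ-syntax; ∃; _×_; _,_; proj₁; proj₂)
  open import Data.Product.Properties using (≡-dec)
  open import Data.Empty using (⊥-elim)
  open import Relation.Nullary using (¬_; Dec; yes; no)
  open import Relation.Nullary.Decidable using (_×-dec_)
  open import Relation.Unary using (Decidable)
  open import Relation.Binary.PropositionalEquality
  open import Function using (_∘_)
  open import Defs
  open FiniteSums
  open RowShift
  open ListFacts
  open Numbering
  open Filling

  open Setup μ l γ ρ j m ρm public

  module O (h : Fin n) = ShiftOrbits (l h) {{>-nonZero (l>0 h)}} j (μ h) (γ h) (γ-order h) (μ-nonempty h)

  ρ>0 : ∀ k → 0 < ρ_ k
  ρ>0 k = All.lookup ρ-positive (∈-lookup k)

  position : Fin m → K × ℕ
  position x = locate ρ (cast (sym ρm) x)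

  num : ∀ k t → .(t < ρ_ k) → Fin m
  num k t t<ρk = cast ρm (number ρ k t t<ρk)

  position-num : ∀ k t .(t<ρk : t < ρ_ k) → position (num k t t<ρk) ≡ (k , t)
  position-num k t t<ρk = trans (cong (locate ρ) (cast-involutive (sym ρm) ρm _)) (locate-number ρ k t t<ρk)

  position-< : ∀ x → proj₂ (position x) < ρ_ (proj₁ (position x))
  position-< x = locate-< ρ (cast (sym ρm) x)

  num-position : ∀ x → num (proj₁ (position x)) (proj₂ (position x)) (position-< x) ≡ x
  num-position x = trans (cong (cast ρm) (number-locate ρ (cast (sym ρm) x) (position-< x)))
                         (cast-involutive ρm (sym ρm) x)

  ∑-position : ∀ (g : K → ℕ → ℕ)
             → ∑[ x < m ] g (proj₁ (position x)) (proj₂ (position x)) ≡ ∑[ k < length ρ ] sumTo (ρ_ k) (g k)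
  ∑-position g = begin
    ∑[ x < m ] g (proj₁ (position x)) (proj₂ (position x))
      ≡⟨ ∑-cast ρm _ ⟩
    ∑[ y < sum ρ ] g (proj₁ (position (cast ρm y))) (proj₂ (position (cast ρm y)))
      ≡⟨ sum-cong-≗ (λ y → cong (λ z → g (proj₁ (locate ρ z)) (proj₂ (locate ρ z))) (cast-involutive (sym ρm) ρm y)) ⟩
    ∑[ y < sum ρ ] g (proj₁ (locate ρ y)) (proj₂ (locate ρ y))
      ≡⟨ ∑-locate ρ g ⟩
    ∑[ k < length ρ ] sumTo (ρ_ k) (g k) ∎
    where open ≡-Reasoning

  σρ⁻¹-num-suc : ∀ k t .(t+1<ρk : suc t < ρ_ k) → σρ⁻¹ (num k (suc t) t+1<ρk) ≡ num k t (<-trans (n<1+n t) t+1<ρk)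
  σρ⁻¹-num-suc k t t+1<ρk =
    cong (cast ρm) (trans (cong (σinv ρ) (cast-involutive (sym ρm) ρm _)) (σinv-number-suc ρ k t t+1<ρk))

  σρ⁻¹-num-zero : ∀ k .(0<ρk : 0 < ρ_ k) → σρ⁻¹ (num k 0 0<ρk) ≡ num k (ρ_ k ∸ 1) (n∸1<n (ρ_ k) 0<ρk)
  σρ⁻¹-num-zero k 0<ρk =
    cong (cast ρm) (trans (cong (σinv ρ) (cast-involutive (sym ρm) ρm _)) (σinv-number-zero ρ k 0<ρk))

  _≟R_ : (R R' : Row) → Dec (R ≡ R')
  _≟R_ = ≡-dec F._≟_ _≟_

  coords-injective : ∀ {b b' : Box} → coords b ≡ coords b' → b ≡ b'
  coords-injective {h , i , c} {h' , i' , c'} eq with cong proj₁ eq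
  ... | refl with toℕ-injective (cong (proj₁ ∘ proj₂) eq)
  ... | refl with toℕ-injective (cong (proj₂ ∘ proj₂) eq)
  ... | refl = refl

  box : ∀ h i c → i < length (μ h) → c < at (μ h) i → Box
  box h i c i<len c<μhi = h , fromℕ< i<len , fromℕ< (subst (c <_) (sym row-length) c<μhi)
    where
      row-length : lookup (μ h) (fromℕ< i<len) ≡ at (μ h) i
      row-length = trans (lookup≡at (μ h) (fromℕ< i<len)) (cong (at (μ h)) (toℕ-fromℕ< i<len))

  coords-box : ∀ h i c i<len c<μhi → coords (box h i c i<len c<μhi) ≡ (h , i , c)
  coords-box h i c i<len c<μhi = cong₂ (λ a b → h , a , b) (toℕ-fromℕ< i<len) (toℕ-fromℕ< _)

  box-bounds : ∀ (b : Box) {h i c} → coords b ≡ (h , i , c) → i < length (μ h) × c < at (μ h) i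
  box-bounds (h , i , c) refl = toℕ<n i , subst (toℕ c <_) (lookup≡at (μ h) i) (toℕ<n c)

  private
    rowBoxes : (h : Fin n) → Fin (length (μ h)) → List Box
    rowBoxes h i = map (λ c → h , i , c) (allFin (lookup (μ h) i))

    componentBoxes : Fin n → List Box
    componentBoxes h = concatMap (rowBoxes h) (allFin (length (μ h)))

  ∈-allBoxes : ∀ b → b ∈ allBoxes
  ∈-allBoxes (h , i , c) = ∈-concatMap⁺ componentBoxes (lose (∈-allFin h)
    (∈-concatMap⁺ (rowBoxes h) (lose (∈-allFin i) (∈-map⁺ (λ c → h , i , c) (∈-allFin c)))))

  count-allBoxes : ∀ {P : Box → Set} (P? : Decidable P)
                 → count P? allBoxes ≡ ∑[ h < n ] ∑[ i < length (μ h) ] ∑[ c < lookup (μ h) i ] χ (P? (h , i , c))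
  count-allBoxes P? = trans (count-concatMap-allFin P? n componentBoxes) (sum-cong-≗ λ h →
    trans (count-concatMap-allFin P? (length (μ h)) (rowBoxes h))
          (sum-cong-≗ λ i → count-map-allFin P? (lookup (μ h) i) (λ c → h , i , c)))

  allBoxes-rowSorted : AllPairs (λ b b' → proj₁ b ≡ proj₁ b' → rowOf b ≤ rowOf b') allBoxes
  allBoxes-rowSorted = concatMap-sorted n componentBoxes within-component across-components
    where
      Before : Box → Box → Set
      Before b b' = proj₁ b ≡ proj₁ b' → rowOf b ≤ rowOf b'
      concatMap-sorted : ∀ {A : Set} {R : A → A → Set} N (f : Fin N → List A) → (∀ i → AllPairs R (f i))
                       → (∀ {i i'} → i F.< i' → All (λ x → All (R x) (f i')) (f i)) → AllPairs R (concatMap f (allFin N))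
      concatMap-sorted N f inside across =
        AllPairs.concat⁺ (All.map⁺ (All.tabulate⁺ inside)) (AllPairs.map⁺ (AllPairs.tabulate⁺-< across))
      in-component : ∀ h → All (λ b → proj₁ b ≡ h) (componentBoxes h)
      in-component h = concatMap-all (length (μ h)) (rowBoxes h) (λ i → All.map⁺ (All.tabulate⁺ λ c → refl))
        where
          concatMap-all : ∀ {A : Set} {P : A → Set} N (f : Fin N → List A)
                        → (∀ i → All P (f i)) → All P (concatMap f (allFin N))
          concatMap-all N f inside = All.concat⁺ (All.map⁺ (All.tabulate⁺ inside))
      within-component : ∀ h → AllPairs Before (componentBoxes h)
      within-component h = concatMap-sorted (length (μ h)) (rowBoxes h)
        (λ i → AllPairs.map⁺ (AllPairs.tabulate⁺ λ _ _ → ≤-refl))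
        (λ i<i' → All.map⁺ (All.tabulate⁺ λ c → All.map⁺ (All.tabulate⁺ λ c' _ → <⇒≤ i<i')))
      across-components : ∀ {h h'} → h F.< h' → All (λ b → All (Before b) (componentBoxes h')) (componentBoxes h)
      across-components {h} {h'} h<h' =
        All.map (λ b∈h → All.map (λ b'∈h' same → ⊥-elim (h≢h' (trans (sym b∈h) (trans same b'∈h')))) (in-component h'))
                (in-component h)
        where
          h≢h' : h ≢ h'
          h≢h' h≡h' = <-irrefl (cong toℕ h≡h') h<h'

  private
    rowCount′ : (Box → K) → ∀ h i → K → Dec (i < length (μ h)) → ℕ
    rowCount′ Y' h i k (yes i<len) = ∑[ c < lookup (μ h) (fromℕ< i<len) ] χ (Y' (h , fromℕ< i<len , c) F.≟ k)
    rowCount′ Y' h i k (no _) = 0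

  rowCount : (Box → K) → Row → K → ℕ
  rowCount Y' (h , i) k = rowCount′ Y' h i k (i <? length (μ h))

  ∑-rowCount : ∀ Y' R → ∑[ k < length ρ ] rowCount Y' R k ≡ rowLen R
  ∑-rowCount Y' (h , i) = by-row (i <? length (μ h))
    where
      by-row : (i<len? : Dec (i < length (μ h))) → ∑[ k < length ρ ] rowCount′ Y' h i k i<len? ≡ at (μ h) i
      by-row (yes i<len) = trans (∑-fibres (length ρ) _ (λ c → Y' (h , fromℕ< i<len , c)))
                                 (trans (lookup≡at (μ h) (fromℕ< i<len)) (cong (at (μ h)) (toℕ-fromℕ< i<len)))
      by-row (no i≮len) = trans (∑-zero (length ρ) λ _ → refl) (sym (at-≥length (μ h) i (≮⇒≥ i≮len)))

  rowCount-row : ∀ Y' h (i : Fin (length (μ h))) k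
               → rowCount Y' (h , toℕ i) k ≡ ∑[ c < lookup (μ h) i ] χ (Y' (h , i , c) F.≟ k)
  rowCount-row Y' h i k = by-row (toℕ i <? length (μ h))
    where
      by-row : (i<len? : Dec (toℕ i < length (μ h)))
             → rowCount′ Y' h (toℕ i) k i<len? ≡ ∑[ c < lookup (μ h) i ] χ (Y' (h , i , c) F.≟ k)
      by-row (yes i<len) rewrite fromℕ<-toℕ i i<len = refl
      by-row (no i≮len) = ⊥-elim (i≮len (toℕ<n i))

  rowCount-zero : ∀ Y' h i k → (∀ (b : Box) → proj₁ b ≡ h → rowOf b ≡ i → Y' b ≢ k) → rowCount Y' (h , i) k ≡ 0
  rowCount-zero Y' h i k none = by-row (i <? length (μ h))
    where
      by-row : (i<len? : Dec (i < length (μ h))) → rowCount′ Y' h i k i<len? ≡ 0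
      by-row (yes i<len) = ∑-zero _ λ c → χ-no (Y' (h , fromℕ< i<len , c) F.≟ k) (none _ refl (toℕ-fromℕ< i<len))
      by-row (no _) = refl

  rowCount-< : ∀ Y' h i (i<len : i < length (μ h)) k
             → rowCount Y' (h , i) k ≡ ∑[ c < lookup (μ h) (fromℕ< i<len) ] χ (Y' (h , fromℕ< i<len , c) F.≟ k)
  rowCount-< Y' h i i<len k = by-row (i <? length (μ h))
    where
      by-row : (i<len? : Dec (i < length (μ h)))
             → rowCount′ Y' h i k i<len? ≡ ∑[ c < lookup (μ h) (fromℕ< i<len) ] χ (Y' (h , fromℕ< i<len , c) F.≟ k)
      by-row (yes _) = refl
      by-row (no i≮len) = ⊥-elim (i≮len i<len)

  orbitRow : Fin n → ℕ → ℕ → Row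
  orbitRow h r t = h , rowShift (l h) (ℤ.- (j ℤ.* ℤ.+ t)) r

  orbitRow-0 : ∀ h r → orbitRow h r 0 ≡ (h , r)
  orbitRow-0 h r = cong (h ,_) (trans (cong (λ e → rowShift (l h) (ℤ.- e) r) (ℤP.*-zeroʳ j)) (rowShift-0 (l h) r))

  shiftRow-orbitRow : ∀ h r t → shiftRow j (orbitRow h r (suc t)) ≡ orbitRow h r t
  shiftRow-orbitRow h r t = cong (h ,_) (trans (rowShift-+ (l h) j _ r) (cong (λ e → rowShift (l h) e r) j-j[1+t]≡-jt))
    where
      open +-*-Solver
      j-j[1+t]≡-jt : j ℤ.+ ℤ.- (j ℤ.* ℤ.+ suc t) ≡ ℤ.- (j ℤ.* ℤ.+ t)
      j-j[1+t]≡-jt = trans (cong (λ z → j ℤ.+ ℤ.- (j ℤ.* z)) (pos-+ 1 t))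
                           (solve 2 (λ j t → j :+ :- (j :* (con (ℤ.+ 1) :+ t)) := :- (j :* t)) refl j (ℤ.+ t))

  shiftRow-injective : ∀ {R R'} → shiftRow j R ≡ shiftRow j R' → R ≡ R'
  shiftRow-injective {h , r} {h' , r'} eq with cong proj₁ eq
  ... | refl = cong (h ,_) (begin
    r                                             ≡⟨ rowShift-inverseˡ (l h) j r ⟨
    rowShift (l h) (ℤ.- j) (rowShift (l h) j r)   ≡⟨ cong (rowShift (l h) (ℤ.- j) ∘ proj₂) eq ⟩
    rowShift (l h) (ℤ.- j) (rowShift (l h) j r')  ≡⟨ rowShift-inverseˡ (l h) j r' ⟩
    r'                                            ∎)
    where open ≡-Reasoning

  orbitRow-period⇒ : ∀ h r t → γ h ∣ t → orbitRow h r t ≡ (h , r)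
  orbitRow-period⇒ h r t γ∣t = cong (h ,_) (begin
    rowShift (l h) (ℤ.- (j ℤ.* ℤ.+ t)) r                               ≡⟨ cong (rowShift (l h) _) (O.rowShift-order⇒ h t r γ∣t) ⟨
    rowShift (l h) (ℤ.- (j ℤ.* ℤ.+ t)) (rowShift (l h) (j ℤ.* ℤ.+ t) r)  ≡⟨ rowShift-inverseˡ (l h) (j ℤ.* ℤ.+ t) r ⟩
    r                                                                  ∎)
    where open ≡-Reasoning

  orbitRow-period⇐ : ∀ h r t → orbitRow h r t ≡ (h , r) → γ h ∣ t
  orbitRow-period⇐ h r t back = O.rowShift-order⇐ h t r (begin
    rowShift (l h) (j ℤ.* ℤ.+ t) r                                     ≡⟨ cong (rowShift (l h) _ ∘ proj₂) back ⟨
    rowShift (l h) (j ℤ.* ℤ.+ t) (rowShift (l h) (ℤ.- (j ℤ.* ℤ.+ t)) r)  ≡⟨ rowShift-inverseʳ (l h) (j ℤ.* ℤ.+ t) r ⟩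
    r                                                                  ∎)
    where open ≡-Reasoning

  visits : Fin n → ℕ → ℕ → Row → ℕ
  visits h r N R = sumTo N (λ t → χ (orbitRow h r t ≟R R))

  visits-other : ∀ h r N {h' i} → h' ≢ h → visits h r N (h' , i) ≡ 0
  visits-other h r N h'≢h = sumTo-zero N λ t _ → χ-no (orbitRow h r t ≟R _) λ same → h'≢h (sym (cong proj₁ same))

  visits-same : ∀ h r w i → visits h r (w * γ h) (h , i) ≡ w * χ (O.sameOrbit? h i r)
  visits-same h r w i = trans
    (sumTo-cong (w * γ h) λ t _ → χ-⇔ (orbitRow h r t ≟R (h , i)) (proj₂ (orbitRow h r t) ≟ i) (cong proj₂) (cong (h ,_)))
    (O.count-orbit h w r i)

  module Marked (P : MarkedTabloid) where

    comp : K → Fin n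
    comp k = proj₁ (shape P k)

    top : K → ℕ
    top k = proj₁ (proj₂ (shape P k))

    left : K → ℕ
    left k = proj₁ (proj₂ (proj₂ (shape P k)))

    width : K → ℕ
    width k = div (ρ_ k) (γ (comp k))

    γ∣ρ : ∀ k → γ (comp k) ∣ ρ_ k
    γ∣ρ k = proj₁ (proj₂ (proj₂ (proj₂ (shape P k))))

    Y⁻¹⊆ : ∀ k b → Y P b ≡ k
         → ∃ λ s → ∃ λ t → s < γ (comp k) × t < width k × coords b ≡ (comp k , top k + s * O.d (comp k) , left k + t)
    Y⁻¹⊆ k = proj₁ (proj₂ (proj₂ (proj₂ (proj₂ (shape P k)))))

    Y⁻¹⊇ : ∀ k s t → s < γ (comp k) → t < width k
         → Σ[ b ∈ Box ] (coords b ≡ (comp k , top k + s * O.d (comp k) , left k + t) × Y P b ≡ k)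
    Y⁻¹⊇ k = proj₂ (proj₂ (proj₂ (proj₂ (proj₂ (shape P k)))))

    ρ≡width*γ : ∀ k → ρ_ k ≡ width k * γ (comp k)
    ρ≡width*γ k = ∣⇒≡div* (O.γ>0 (comp k)) (γ∣ρ k)

    width>0 : ∀ k → 0 < width k
    width>0 k = n≢0⇒n>0 λ width≡0 → <⇒≢ (ρ>0 k) (sym (trans (ρ≡width*γ k) (cong (_* γ (comp k)) width≡0)))

    corner : K → Box
    corner k = proj₁ (Y⁻¹⊇ k 0 0 (O.γ>0 (comp k)) (width>0 k))

    coords-corner : ∀ k → coords (corner k) ≡ (comp k , top k , left k)
    coords-corner k = trans (proj₁ (proj₂ (Y⁻¹⊇ k 0 0 (O.γ>0 (comp k)) (width>0 k))))
                            (cong₂ (λ a b → comp k , a , b) (+-identityʳ (top k)) (+-identityʳ (left k)))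

    Y-corner : ∀ k → Y P (corner k) ≡ k
    Y-corner k = proj₂ (proj₂ (Y⁻¹⊇ k 0 0 (O.γ>0 (comp k)) (width>0 k)))

    comp-c : ∀ k → proj₁ (c P k) ≡ comp k
    comp-c k = trans (sym (c-comp P k (corner k) (Y-corner k))) (cong proj₁ (coords-corner k))

    Y-at : ∀ k b s t → s < γ (comp k) → t < width k
         → coords b ≡ (comp k , top k + s * O.d (comp k) , left k + t) → Y P b ≡ k
    Y-at k b s t s<γ t<w coords≡ with Y⁻¹⊇ k s t s<γ t<w
    ... | b' , coords'≡ , Yb'≡k = trans (cong (Y P) (coords-injective (trans coords≡ (sym coords'≡)))) Yb'≡k

    rowsOf≡progression : ∀ k → rowsOf (Y P) k ≡ progression (top k) (O.d (comp k)) (γ (comp k))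
    rowsOf≡progression k =
      strictlySorted-≡ (deduplicate-sorted rows-sorted) (progression-sorted _ _ _ (O.d>0 (comp k))) ⊆progression ⊇progression
      where
        Y≡k? = λ b → Y P b F.≟ k
        boxes = filter Y≡k? allBoxes
        in-comp : All (λ b → proj₁ b ≡ comp k) boxes
        in-comp = All.map (λ {b} Yb≡k → let (_ , _ , _ , _ , coords≡) = Y⁻¹⊆ k b Yb≡k in cong proj₁ coords≡)
                          (All.all-filter Y≡k? allBoxes)
        rows-sorted : AllPairs _≤_ (map rowOf boxes)
        rows-sorted = AllPairs.map⁺ (AllPairs-weaken (λ b∈ b'∈ before → before (trans b∈ (sym b'∈))) in-comp
                                                     (AllPairs.filter⁺ Y≡k? allBoxes-rowSorted))
        ⊆progression : ∀ {i} → i ∈ rowsOf (Y P) k → i ∈ progression (top k) (O.d (comp k)) (γ (comp k))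
        ⊆progression i∈ with ∈-map⁻ rowOf (∈-deduplicate⁻ _≟_ (map rowOf boxes) i∈)
        ... | b , b∈ , refl with Y⁻¹⊆ k b (proj₂ (∈-filter⁻ Y≡k? {xs = allBoxes} b∈))
        ... | s , _ , s<γ , _ , coords≡ =
          subst (_∈ progression _ _ _) (sym (cong (proj₁ ∘ proj₂) coords≡)) (∈-progression⁺ _ _ _ s s<γ)
        ⊇progression : ∀ {i} → i ∈ progression (top k) (O.d (comp k)) (γ (comp k)) → i ∈ rowsOf (Y P) k
        ⊇progression i∈ with ∈-progression⁻ _ _ _ i∈
        ... | s , s<γ , refl with Y⁻¹⊇ k s 0 s<γ (width>0 k)
        ... | b , coords≡ , Yb≡k = ∈-deduplicate⁺ _≟_ (subst (_∈ map rowOf boxes) (cong (proj₁ ∘ proj₂) coords≡)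
                                                       (∈-map⁺ rowOf (∈-filter⁺ Y≡k? (∈-allBoxes b) Yb≡k)))

    -- The box d rows above the corner of a misaligned Y⁻¹(k) exists since μ is a partition. It is not in
    -- Y⁻¹(k), so it lies in the bottom row of some Y⁻¹(k') (else the corner of Y⁻¹(k) would be in Y⁻¹(k') too),
    -- and then Y⁻¹(k') starts L rows higher.
    misaligned-above : ∀ k → ¬ O.Aligned (comp k) (top k) → ∃ λ k' → top k' < top k × ¬ O.Aligned (comp k') (top k')
    misaligned-above k ¬aligned = k' , bottom-row (suc s' <? γ (comp k'))
      where
        h = comp k
        D = O.d h
        i' = top k ∸ D
        i'+D≡top : i' + D ≡ top k
        i'+D≡top = m∸n+n≡m (O.¬aligned⇒d≤ h (top k) ¬aligned)
        i'<top : i' < top k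
        i'<top = subst (i' <_) i'+D≡top (m<m+n i' (O.d>0 h))
        corner-bounds = box-bounds (corner k) (coords-corner k)
        i'<len = <-trans i'<top (proj₁ corner-bounds)
        left<row = <-≤-trans (proj₂ corner-bounds) (at-antitone (μ h) (μ-decreasing h) (<⇒≤ i'<top))
        b' = box h i' (left k) i'<len left<row
        k' = Y P b'
        in-k' = Y⁻¹⊆ k' b' refl
        s' = proj₁ in-k'
        t' = proj₁ (proj₂ in-k')
        d' = O.d (comp k')
        same : (h , i' , left k) ≡ (comp k' , top k' + s' * d' , left k' + t')
        same = trans (sym (coords-box h i' (left k) i'<len left<row)) (proj₂ (proj₂ (proj₂ (proj₂ in-k'))))
        comp≡ : comp k' ≡ h
        comp≡ = sym (cong proj₁ same)
        next≡top : top k' + suc s' * d' ≡ top k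
        next≡top = begin
          top k' + (d' + s' * d')  ≡⟨ cong (top k' +_) (+-comm d' (s' * d')) ⟩
          top k' + (s' * d' + d')  ≡⟨ +-assoc (top k') (s' * d') d' ⟨
          top k' + s' * d' + d'    ≡⟨ cong₂ _+_ (sym (cong (proj₁ ∘ proj₂) same)) (cong O.d comp≡) ⟩
          i' + D                   ≡⟨ i'+D≡top ⟩
          top k                    ∎
          where open ≡-Reasoning
        bottom-row : Dec (suc s' < γ (comp k')) → top k' < top k × ¬ O.Aligned (comp k') (top k')
        bottom-row (yes s'+1<γ) = ⊥-elim (<⇒≱ i'<top (subst (top k ≤_) (sym i'≡) (m≤m+n (top k) _)))
          where
            corner-in-k' : Y P (corner k) ≡ k'
            corner-in-k' = Y-at k' (corner k) (suc s') t' s'+1<γ (proj₁ (proj₂ (proj₂ (proj₂ in-k'))))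
              (trans (coords-corner k) (cong₂ _,_ (sym comp≡) (cong₂ _,_ (sym next≡top) (cong (proj₂ ∘ proj₂) same))))
            in-k = Y⁻¹⊆ k b' (trans (sym corner-in-k') (Y-corner k))
            i'≡ : i' ≡ top k + proj₁ in-k * D
            i'≡ = cong (proj₁ ∘ proj₂) (trans (sym (coords-box h i' (left k) i'<len left<row))
                                              (proj₂ (proj₂ (proj₂ (proj₂ in-k)))))
        bottom-row (no s'+1≮γ) =
          top'<top , λ aligned' → ¬aligned (subst₂ O.Aligned comp≡ top'+L≡top (O.aligned-+L (comp k') (top k') aligned'))
          where
            s'+1≡γ : suc s' ≡ γ (comp k')
            s'+1≡γ = ≤-antisym (proj₁ (proj₂ (proj₂ in-k'))) (≮⇒≥ s'+1≮γ)
            top'+L≡top : top k' + l (comp k') ≡ top k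
            top'+L≡top = trans (cong (top k' +_) (trans (sym (O.γ*d≡L (comp k'))) (cong (_* d') (sym s'+1≡γ)))) next≡top
            top'<top : top k' < top k
            top'<top = subst (top k' <_) top'+L≡top (m<m+n (top k') (l>0 (comp k')))

    top-aligned : ∀ k → O.Aligned (comp k) (top k)
    top-aligned k = <-rec (λ N → ∀ k → top k ≡ N → O.Aligned (comp k) (top k)) step (top k) k refl
      where
        step : ∀ N → (∀ {M} → M < N → ∀ k → top k ≡ M → O.Aligned (comp k) (top k))
             → ∀ k → top k ≡ N → O.Aligned (comp k) (top k)
        step N IH k refl with O.aligned? (comp k) (top k)
        ... | yes aligned = aligned
        ... | no ¬aligned = let (k' , top'<top , ¬aligned') = misaligned-above k ¬aligned
                            in ⊥-elim (¬aligned' (IH top'<top k' refl))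

    InOrbit : K → ℕ → Set
    InOrbit k i = O.SameOrbit (comp k) i (top k)

    progression⇒InOrbit : ∀ k s → s < γ (comp k) → InOrbit k (top k + s * O.d (comp k))
    progression⇒InOrbit k s s<γ = O.progression⇒SameOrbit (comp k) (top k) s (top-aligned k) s<γ

    InOrbit⇒progression : ∀ k i → InOrbit k i → ∃ λ s → s < γ (comp k) × i ≡ top k + s * O.d (comp k)
    InOrbit⇒progression k i = O.SameOrbit⇒progression (comp k) (top k) i (top-aligned k)

    rowCount-other : ∀ k {h i} → h ≢ comp k → rowCount (Y P) (h , i) k ≡ 0
    rowCount-other k h≢ = rowCount-zero (Y P) _ _ k λ b b∈h _ Yb≡k →
      h≢ (trans (sym b∈h) (cong proj₁ (proj₂ (proj₂ (proj₂ (proj₂ (Y⁻¹⊆ k b Yb≡k)))))))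

    rowCount-outside : ∀ k i → ¬ InOrbit k i → rowCount (Y P) (comp k , i) k ≡ 0
    rowCount-outside k i ¬inOrbit = rowCount-zero (Y P) (comp k) i k λ b _ b-row Yb≡k →
      let (s , _ , s<γ , _ , coords≡) = Y⁻¹⊆ k b Yb≡k
      in ¬inOrbit (subst (InOrbit k) (trans (sym (cong (proj₁ ∘ proj₂) coords≡)) b-row) (progression⇒InOrbit k s s<γ))

    column-range : ∀ k b → Y P b ≡ k → left k ≤ toℕ (proj₂ (proj₂ b)) × toℕ (proj₂ (proj₂ b)) < left k + width k
    column-range k b Yb≡k =
      subst (left k ≤_) (sym col≡) (m≤m+n (left k) t) , subst (_< left k + width k) (sym col≡) (+-monoʳ-< (left k) t<w)
      where
        in-k = Y⁻¹⊆ k b Yb≡k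
        t = proj₁ (proj₂ in-k)
        t<w : t < width k
        t<w = proj₁ (proj₂ (proj₂ (proj₂ in-k)))
        col≡ : toℕ (proj₂ (proj₂ b)) ≡ left k + t
        col≡ = cong (proj₂ ∘ proj₂) (proj₂ (proj₂ (proj₂ (proj₂ in-k))))

    rowCount-inside : ∀ k i → InOrbit k i → rowCount (Y P) (comp k , i) k ≡ width k
    rowCount-inside k i inOrbit = begin
      rowCount (Y P) (h , i) k
        ≡⟨ rowCount-< (Y P) h i i<len k ⟩
      ∑[ c < lookup (μ h) i' ] χ (Y P (h , i' , c) F.≟ k)
        ≡⟨ sum-cong-≗ {lookup (μ h) i'} (λ c → trans (χ-⇔ (Y P (h , i' , c) F.≟ k) (in-columns? (toℕ c)) (column-range k (h , i' , c)) (⇒columns c))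
                                                     (χ-× (left k ≤? toℕ c) (toℕ c <? left k + width k))) ⟩
      sumTo (lookup (μ h) i') (λ c → χ (left k ≤? c) * χ (c <? left k + width k))
        ≡⟨ sumTo-interval _ (left k) (width k) right≤len ⟩
      width k ∎
      where
        open ≡-Reasoning
        h = comp k
        in-row = InOrbit⇒progression k i inOrbit
        s = proj₁ in-row
        s<γ = proj₁ (proj₂ in-row)
        i≡ = proj₂ (proj₂ in-row)
        last = Y⁻¹⊇ k s (width k ∸ 1) s<γ (n∸1<n (width k) (width>0 k))
        last-bounds = box-bounds (proj₁ last) (proj₁ (proj₂ last))
        i<len : i < length (μ h)
        i<len = subst (_< length (μ h)) (sym i≡) (proj₁ last-bounds)
        i' = fromℕ< i<len
        right≤len : left k + width k ≤ lookup (μ h) i'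
        right≤len = subst₂ _≤_ (trans (sym (+-suc (left k) (width k ∸ 1))) (cong (left k +_) (m+[n∸m]≡n (width>0 k))))
                               (sym (trans (lookup≡at (μ h) i') (cong (at (μ h)) (trans (toℕ-fromℕ< i<len) i≡))))
                               (proj₂ last-bounds)
        in-columns? = λ c → (left k ≤? c) ×-dec (c <? left k + width k)
        ⇒columns : ∀ c → left k ≤ toℕ c × toℕ c < left k + width k → Y P (h , i' , c) ≡ k
        ⇒columns c (left≤c , c<right) = Y-at k (h , i' , c) s (toℕ c ∸ left k) s<γ
          (+-cancelˡ-< (left k) _ _ (subst (_< left k + width k) (sym (m+[n∸m]≡n left≤c)) c<right))
          (cong₂ (λ x y → h , x , y) (trans (toℕ-fromℕ< i<len) i≡) (sym (m+[n∸m]≡n left≤c)))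

    rowCount-comp : ∀ k i → rowCount (Y P) (comp k , i) k ≡ width k * χ (O.sameOrbit? (comp k) i (top k))
    rowCount-comp k i with O.sameOrbit? (comp k) i (top k)
    ... | yes inOrbit = trans (rowCount-inside k i inOrbit) (sym (*-identityʳ (width k)))
    ... | no ¬inOrbit = trans (rowCount-outside k i ¬inOrbit) (sym (*-zeroʳ (width k)))

    start : K → ℕ
    start k = at (rowsOf (Y P) k) (toℕ (proj₂ (c P k)))

    φ-num : ∀ k t .(t<ρk : t < ρ_ k) → φ P (num k t t<ρk) ≡ orbitRow (proj₁ (c P k)) (start k) t
    φ-num k t t<ρk = cong (λ (k , t) → orbitRow (proj₁ (c P k)) (start k) t) (position-num k t t<ρk)

    start-in-orbit : ∀ k → ∃ λ v → v < γ (comp k)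
                   × (∀ t → orbitRow (proj₁ (c P k)) (start k) t ≡ orbitRow (comp k) (top k + v * O.d (comp k)) t)
    start-in-orbit k = marked-row (c P k) (comp-c k)
      where
        marked-row : ∀ (cₖ : Σ[ h ∈ Fin n ] Fin (γ h)) → proj₁ cₖ ≡ comp k
                   → ∃ λ v → v < γ (comp k)
                   × (∀ t → orbitRow (proj₁ cₖ) (at (rowsOf (Y P) k) (toℕ (proj₂ cₖ))) t ≡ orbitRow (comp k) (top k + v * O.d (comp k)) t)
        marked-row (h , v) refl = toℕ v , toℕ<n v , λ t → cong (λ r → orbitRow h r t)
          (trans (cong (λ rows → at rows (toℕ v)) (rowsOf≡progression k)) (at-progression _ _ _ (toℕ v) (toℕ<n v)))

    count-φ-row : ∀ k R → sumTo (ρ_ k) (λ t → χ (orbitRow (proj₁ (c P k)) (start k) t ≟R R)) ≡ rowCount (Y P) R k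
    count-φ-row k (h , i) = by-comp h (h F.≟ comp k)
      where
        v = proj₁ (start-in-orbit k)
        r₀ = top k + v * O.d (comp k)
        r₀-inOrbit : InOrbit k r₀
        r₀-inOrbit = progression⇒InOrbit k v (proj₁ (proj₂ (start-in-orbit k)))
        as-visits : ∀ R → sumTo (ρ_ k) (λ t → χ (orbitRow (proj₁ (c P k)) (start k) t ≟R R)) ≡ visits (comp k) r₀ (ρ_ k) R
        as-visits R = sumTo-cong (ρ_ k) λ t _ → cong (λ z → χ (z ≟R R)) (proj₂ (proj₂ (start-in-orbit k)) t)
        by-comp : ∀ h → Dec (h ≡ comp k)
                → sumTo (ρ_ k) (λ t → χ (orbitRow (proj₁ (c P k)) (start k) t ≟R (h , i))) ≡ rowCount (Y P) (h , i) k
        by-comp h (no h≢) = trans (as-visits (h , i)) (trans (visits-other (comp k) r₀ (ρ_ k) h≢) (sym (rowCount-other k h≢)))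
        by-comp .(comp k) (yes refl) = begin
          sumTo (ρ_ k) (λ t → χ (orbitRow (proj₁ (c P k)) (start k) t ≟R (comp k , i)))
            ≡⟨ as-visits (comp k , i) ⟩
          visits (comp k) r₀ (ρ_ k) (comp k , i)
            ≡⟨ cong (λ N → visits (comp k) r₀ N (comp k , i)) (ρ≡width*γ k) ⟩
          visits (comp k) r₀ (width k * γ (comp k)) (comp k , i)
            ≡⟨ visits-same (comp k) r₀ (width k) i ⟩
          width k * χ (O.sameOrbit? (comp k) i r₀)
            ≡⟨ cong (width k *_) (χ-⇔ (O.sameOrbit? (comp k) i r₀) (O.sameOrbit? (comp k) i (top k))
              (λ same → O.SameOrbit-trans (comp k) same r₀-inOrbit)
              (λ same → O.SameOrbit-trans (comp k) same (O.SameOrbit-sym (comp k) r₀-inOrbit))) ⟩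
          width k * χ (O.sameOrbit? (comp k) i (top k))
            ≡⟨ rowCount-comp k i ⟨
          rowCount (Y P) (comp k , i) k ∎
          where open ≡-Reasoning

    φ-isTabloid : IsTabloid (φ P)
    φ-isTabloid R = begin
      count (λ x → φ P x ≟R R) (allFin m)
        ≡⟨ count-tabulate (λ x → φ P x ≟R R) m (λ x → x) ⟩
      ∑[ x < m ] χ (φ P x ≟R R)
        ≡⟨ ∑-position (λ k t → χ (orbitRow (proj₁ (c P k)) (start k) t ≟R R)) ⟩
      ∑[ k < length ρ ] sumTo (ρ_ k) (λ t → χ (orbitRow (proj₁ (c P k)) (start k) t ≟R R))
        ≡⟨ sum-cong-≗ (λ k → count-φ-row k R) ⟩
      ∑[ k < length ρ ] rowCount (Y P) R k
        ≡⟨ ∑-rowCount (Y P) R ⟩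
      rowLen R ∎
      where open ≡-Reasoning

    -- the cycle of σ_ρ through n_{ρ,k}, …, n_{ρ,k} + ρ_k - 1 closes up because γ ∣ ρ_k
    φ-cond-num : ∀ k t .(t<ρk : t < ρ_ k) → φ P (σρ⁻¹ (num k t t<ρk)) ≡ shiftRow j (φ P (num k t t<ρk))
    φ-cond-num k (suc t) t<ρk = begin
      φ P (σρ⁻¹ (num k (suc t) t<ρk))                ≡⟨ cong (φ P) (σρ⁻¹-num-suc k t t<ρk) ⟩
      φ P (num k t _)                                ≡⟨ φ-num k t _ ⟩
      orbitRow (proj₁ (c P k)) (start k) t           ≡⟨ shiftRow-orbitRow (proj₁ (c P k)) (start k) t ⟨
      shiftRow j (orbitRow (proj₁ (c P k)) (start k) (suc t))  ≡⟨ cong (shiftRow j) (φ-num k (suc t) t<ρk) ⟨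
      shiftRow j (φ P (num k (suc t) t<ρk))          ∎
      where open ≡-Reasoning
    φ-cond-num k zero 0<ρk = begin
      φ P (σρ⁻¹ (num k 0 0<ρk))
        ≡⟨ cong (φ P) (σρ⁻¹-num-zero k 0<ρk) ⟩
      φ P (num k (ρ_ k ∸ 1) _)
        ≡⟨ φ-num k (ρ_ k ∸ 1) _ ⟩
      orbitRow hc (start k) (ρ_ k ∸ 1)
        ≡⟨ shiftRow-orbitRow hc (start k) (ρ_ k ∸ 1) ⟨
      shiftRow j (orbitRow hc (start k) (1 + (ρ_ k ∸ 1)))
        ≡⟨ cong (λ t → shiftRow j (orbitRow hc (start k) t)) (m+[n∸m]≡n (ρ>0 k)) ⟩
      shiftRow j (orbitRow hc (start k) (ρ_ k))
        ≡⟨ cong (shiftRow j) (orbitRow-period⇒ hc (start k) (ρ_ k) γ∣ρk) ⟩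
      shiftRow j (hc , start k)
        ≡⟨ cong (shiftRow j) (orbitRow-0 hc (start k)) ⟨
      shiftRow j (orbitRow hc (start k) 0)
        ≡⟨ cong (shiftRow j) (φ-num k 0 0<ρk) ⟨
      shiftRow j (φ P (num k 0 0<ρk)) ∎
      where
        open ≡-Reasoning
        hc = proj₁ (c P k)
        γ∣ρk : γ hc ∣ ρ_ k
        γ∣ρk = subst (λ h → γ h ∣ ρ_ k) (sym (comp-c k)) (γ∣ρ k)

    φ-cond : Cond (φ P)
    φ-cond y = subst (λ x → φ P (σρ⁻¹ x) ≡ shiftRow j (φ P x)) (num-position y) (φ-cond-num _ _ (position-< y))

  rowsOf-cong : ∀ {Y₁ Y₂ : Box → K} → (∀ b → Y₁ b ≡ Y₂ b) → ∀ k → rowsOf Y₁ k ≡ rowsOf Y₂ k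
  rowsOf-cong {Y₁} {Y₂} Y₁≗Y₂ k = cong (deduplicate _≟_ ∘ map rowOf)
    (filter-≐ (λ b → Y₁ b F.≟ k) (λ b → Y₂ b F.≟ k) ((λ {b} → trans (sym (Y₁≗Y₂ b))) , (λ {b} → trans (Y₁≗Y₂ b)))
              allBoxes)

  mark-≡ : ∀ (a b : Σ[ h ∈ Fin n ] Fin (γ h)) → proj₁ a ≡ proj₁ b → toℕ (proj₂ a) ≡ toℕ (proj₂ b) → a ≡ b
  mark-≡ (h , v) (.h , v') refl v≡v' = cong (h ,_) (toℕ-injective v≡v')

  -- Y is recovered row by row from the row counts (rows of Y are weakly increasing), and c from φ at n_{ρ,k}.
  φ-injective : ∀ P Q → (∀ x → φ P x ≡ φ Q x) → SameMarked P Q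
  φ-injective P Q φP≗φQ = Y≡ , c≡
    where
      module MP = Marked P
      module MQ = Marked Q
      orbit≡ : ∀ k t → t < ρ_ k → orbitRow (proj₁ (c P k)) (MP.start k) t ≡ orbitRow (proj₁ (c Q k)) (MQ.start k) t
      orbit≡ k t t<ρk = trans (sym (MP.φ-num k t t<ρk)) (trans (φP≗φQ (num k t t<ρk)) (MQ.φ-num k t t<ρk))
      Y≡ : ∀ b → Y P b ≡ Y Q b
      Y≡ (h , i , col) = monotone-≡ (length ρ) (lookup (μ h) i) (λ c → Y P (h , i , c)) (λ c → Y Q (h , i , c))
                                    (rowWeak P h i) (rowWeak Q h i) same-fibres col
        where
          open ≡-Reasoning
          R = (h , toℕ i)
          same-fibres : ∀ k → ∑[ c < lookup (μ h) i ] χ (Y P (h , i , c) F.≟ k)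
                            ≡ ∑[ c < lookup (μ h) i ] χ (Y Q (h , i , c) F.≟ k)
          same-fibres k = begin
            ∑[ c < lookup (μ h) i ] χ (Y P (h , i , c) F.≟ k)
              ≡⟨ rowCount-row (Y P) h i k ⟨
            rowCount (Y P) R k
              ≡⟨ MP.count-φ-row k R ⟨
            sumTo (ρ_ k) (λ t → χ (orbitRow (proj₁ (c P k)) (MP.start k) t ≟R R))
              ≡⟨ sumTo-cong (ρ_ k) (λ t t<ρk → cong (λ z → χ (z ≟R R)) (orbit≡ k t t<ρk)) ⟩
            sumTo (ρ_ k) (λ t → χ (orbitRow (proj₁ (c Q k)) (MQ.start k) t ≟R R))
              ≡⟨ MQ.count-φ-row k R ⟩
            rowCount (Y Q) R k
              ≡⟨ rowCount-row (Y Q) h i k ⟩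
            ∑[ c < lookup (μ h) i ] χ (Y Q (h , i , c) F.≟ k) ∎
      c≡ : ∀ k → c P k ≡ c Q k
      c≡ k = mark-≡ (c P k) (c Q k) (cong proj₁ start≡) index≡
        where
          open ≡-Reasoning
          start≡ : (proj₁ (c P k) , MP.start k) ≡ (proj₁ (c Q k) , MQ.start k)
          start≡ = trans (sym (orbitRow-0 _ _)) (trans (orbit≡ k 0 (ρ>0 k)) (orbitRow-0 _ _))
          h = MP.comp k
          rows = progression (MP.top k) (O.d h) (γ h)
          vP = toℕ (proj₂ (c P k))
          vQ = toℕ (proj₂ (c Q k))
          vP<γ : vP < γ h
          vP<γ = subst (λ h → vP < γ h) (MP.comp-c k) (toℕ<n (proj₂ (c P k)))
          vQ<γ : vQ < γ h
          vQ<γ = subst (λ h → vQ < γ h) (trans (sym (cong proj₁ start≡)) (MP.comp-c k)) (toℕ<n (proj₂ (c Q k)))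
          index≡ : vP ≡ vQ
          index≡ = at-progression-injective (MP.top k) (O.d h) (γ h) (O.d>0 h) vP<γ vQ<γ (begin
            at rows vP                  ≡⟨ cong (λ rs → at rs vP) (MP.rowsOf≡progression k) ⟨
            MP.start k                  ≡⟨ cong proj₂ start≡ ⟩
            at (rowsOf (Y Q) k) vQ      ≡⟨ cong (λ rs → at rs vQ) (trans (sym (rowsOf-cong Y≡ k)) (MP.rowsOf≡progression k)) ⟩
            at rows vQ                  ∎)

  -- Fill each row with the values k in increasing order, as many k as f sends numbers n_{ρ,k} + t into that row.
  module Preimage (f : Fin m → Row) (f-tabloid : IsTabloid f) (f-cond : Cond f) where

    comp : K → Fin n
    comp k = proj₁ (f (num k 0 (ρ>0 k)))

    r₀ : K → ℕ
    r₀ k = proj₂ (f (num k 0 (ρ>0 k)))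

    f-num : ∀ k t .(t<ρk : t < ρ_ k) → f (num k t t<ρk) ≡ orbitRow (comp k) (r₀ k) t
    f-num k zero _ = sym (orbitRow-0 (comp k) (r₀ k))
    f-num k (suc t) t+1<ρk = shiftRow-injective (begin
      shiftRow j (f (num k (suc t) t+1<ρk))            ≡⟨ f-cond (num k (suc t) t+1<ρk) ⟨
      f (σρ⁻¹ (num k (suc t) t+1<ρk))                  ≡⟨ cong f (σρ⁻¹-num-suc k t t+1<ρk) ⟩
      f (num k t _)                                    ≡⟨ f-num k t _ ⟩
      orbitRow (comp k) (r₀ k) t                       ≡⟨ shiftRow-orbitRow (comp k) (r₀ k) t ⟨
      shiftRow j (orbitRow (comp k) (r₀ k) (suc t))    ∎)
      where open ≡-Reasoning

    γ∣ρ : ∀ k → γ (comp k) ∣ ρ_ k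
    γ∣ρ k = orbitRow-period⇐ (comp k) (r₀ k) (ρ_ k) (shiftRow-injective (begin
      shiftRow j (orbitRow (comp k) (r₀ k) (ρ_ k))
        ≡⟨ cong (λ t → shiftRow j (orbitRow (comp k) (r₀ k) t)) (m+[n∸m]≡n (ρ>0 k)) ⟨
      shiftRow j (orbitRow (comp k) (r₀ k) (1 + (ρ_ k ∸ 1)))
        ≡⟨ shiftRow-orbitRow (comp k) (r₀ k) (ρ_ k ∸ 1) ⟩
      orbitRow (comp k) (r₀ k) (ρ_ k ∸ 1)
        ≡⟨ f-num k (ρ_ k ∸ 1) _ ⟨
      f (num k (ρ_ k ∸ 1) _)
        ≡⟨ cong f (σρ⁻¹-num-zero k (ρ>0 k)) ⟨
      f (σρ⁻¹ (num k 0 (ρ>0 k)))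
        ≡⟨ f-cond (num k 0 (ρ>0 k)) ⟩
      shiftRow j (comp k , r₀ k) ∎))
      where open ≡-Reasoning

    width : K → ℕ
    width k = div (ρ_ k) (γ (comp k))

    ρ≡width*γ : ∀ k → ρ_ k ≡ width k * γ (comp k)
    ρ≡width*γ k = ∣⇒≡div* (O.γ>0 (comp k)) (γ∣ρ k)

    -- how many boxes of row R get the value k
    quota : Row → K → ℕ
    quota R k = visits (comp k) (r₀ k) (ρ_ k) R

    InOrbit : K → ℕ → Set
    InOrbit k i = O.SameOrbit (comp k) i (r₀ k)

    quota-comp : ∀ k i → quota (comp k , i) k ≡ width k * χ (O.sameOrbit? (comp k) i (r₀ k))
    quota-comp k i = trans (cong (λ N → visits (comp k) (r₀ k) N (comp k , i)) (ρ≡width*γ k))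
                           (visits-same (comp k) (r₀ k) (width k) i)

    quota>0⇒ : ∀ h i k → 0 < quota (h , i) k → h ≡ comp k × InOrbit k i
    quota>0⇒ h i k quota>0 with h F.≟ comp k
    ... | no h≢ = ⊥-elim (<-irrefl (sym (visits-other (comp k) (r₀ k) (ρ_ k) h≢)) quota>0)
    ... | yes refl = refl , χ>0⇒ (O.sameOrbit? h i (r₀ k)) (n≢0⇒n>0 λ χ≡0 →
          <⇒≢ quota>0 (sym (trans (quota-comp k i) (trans (cong (width k *_) χ≡0) (*-zeroʳ (width k))))))

    quota-orbit : ∀ h i i' → O.SameOrbit h i i' → ∀ k → quota (h , i) k ≡ quota (h , i') k
    quota-orbit h i i' same k with h F.≟ comp k
    ... | no h≢ = trans (visits-other (comp k) (r₀ k) (ρ_ k) h≢) (sym (visits-other (comp k) (r₀ k) (ρ_ k) h≢))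
    ... | yes refl = trans (quota-comp k i) (trans (cong (width k *_)
          (χ-⇔ (O.sameOrbit? h i (r₀ k)) (O.sameOrbit? h i' (r₀ k))
               (O.SameOrbit-trans h (O.SameOrbit-sym h same)) (O.SameOrbit-trans h same)))
          (sym (quota-comp k i')))

    ∑-quota : ∀ R → ∑[ k < length ρ ] quota R k ≡ rowLen R
    ∑-quota R = begin
      ∑[ k < length ρ ] quota R k
        ≡⟨ ∑-position (λ k t → χ (orbitRow (comp k) (r₀ k) t ≟R R)) ⟨
      ∑[ x < m ] χ (orbitRow (comp (proj₁ (position x))) (r₀ (proj₁ (position x))) (proj₂ (position x)) ≟R R)
        ≡⟨ sum-cong-≗ (λ x → cong (λ z → χ (z ≟R R)) (trans (sym (f-num _ _ (position-< x))) (cong f (num-position x)))) ⟩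
      ∑[ x < m ] χ (f x ≟R R)
        ≡⟨ count-tabulate (λ x → f x ≟R R) m (λ x → x) ⟨
      count (λ x → f x ≟R R) (allFin m)
        ≡⟨ f-tabloid R ⟩
      rowLen R ∎
      where open ≡-Reasoning

    top : K → ℕ
    top k = O.firstInOrbit (comp k) (r₀ k)

    left : K → ℕ
    left k = prefix (length ρ) (quota (comp k , top k)) k

    top-inOrbit : ∀ k → InOrbit k (top k)
    top-inOrbit k = O.firstInOrbit-SameOrbit (comp k) (r₀ k)

    quota-top : ∀ k → quota (comp k , top k) k ≡ width k
    quota-top k = trans (quota-comp k (top k))
      (trans (cong (width k *_) (χ-yes (O.sameOrbit? (comp k) (top k) (r₀ k)) (top-inOrbit k))) (*-identityʳ (width k)))

    quota-inOrbit : ∀ k h i → h ≡ comp k → InOrbit k i → ∀ k' → quota (h , i) k' ≡ quota (comp k , top k) k'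
    quota-inOrbit k h i refl inOrbit =
      quota-orbit (comp k) i (top k) (O.SameOrbit-trans (comp k) inOrbit (O.SameOrbit-sym (comp k) (top-inOrbit k)))

    progression⇒InOrbit : ∀ k s → s < γ (comp k) → InOrbit k (top k + s * O.d (comp k))
    progression⇒InOrbit k s s<γ =
      O.SameOrbit-trans (comp k) (O.progression⇒SameOrbit (comp k) (top k) s (O.firstInOrbit-aligned (comp k) (r₀ k)) s<γ) (top-inOrbit k)

    InOrbit⇒progression : ∀ k i → InOrbit k i → ∃ λ s → s < γ (comp k) × i ≡ top k + s * O.d (comp k)
    InOrbit⇒progression k i inOrbit = O.SameOrbit⇒progression (comp k) (top k) i (O.firstInOrbit-aligned (comp k) (r₀ k))
                                        (O.SameOrbit-trans (comp k) inOrbit (O.SameOrbit-sym (comp k) (top-inOrbit k)))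

    bound : ∀ h (i : Fin (length (μ h))) (c : Fin (lookup (μ h) i)) → toℕ c < ∑[ k < length ρ ] quota (h , toℕ i) k
    bound h i c = subst (toℕ c <_) (trans (lookup≡at (μ h) i) (sym (∑-quota (h , toℕ i)))) (toℕ<n c)

    Yf : Box → K
    Yf (h , i , c) = fill (length ρ) (quota (h , toℕ i)) (toℕ c) (bound h i c)

    Yf⇒ : ∀ k h i c → Yf (h , i , c) ≡ k → h ≡ comp k × InOrbit k (toℕ i) × left k ≤ toℕ c × toℕ c < left k + width k
    Yf⇒ k h i c Yf≡k =
      h≡ , inOrbit , subst (_≤ toℕ c) prefix≡ lower , subst (toℕ c <_) (cong₂ _+_ prefix≡ (trans (same-quota k) (quota-top k))) upper
      where
        filled = fill⇒ (length ρ) (quota (h , toℕ i)) (toℕ c) (bound h i c) k Yf≡k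
        lower = proj₁ filled
        upper = proj₂ filled
        quota>0 : 0 < quota (h , toℕ i) k
        quota>0 = +-cancelˡ-< (prefix (length ρ) (quota (h , toℕ i)) k) 0 _
                              (≤-<-trans (subst (_≤ toℕ c) (sym (+-identityʳ _)) lower) upper)
        h≡ = proj₁ (quota>0⇒ h (toℕ i) k quota>0)
        inOrbit = proj₂ (quota>0⇒ h (toℕ i) k quota>0)
        same-quota = quota-inOrbit k h (toℕ i) h≡ inOrbit
        prefix≡ = prefix-cong (length ρ) same-quota k

    Yf⇐ : ∀ k h i c → h ≡ comp k → InOrbit k (toℕ i) → left k ≤ toℕ c → toℕ c < left k + width k
        → Yf (h , i , c) ≡ k
    Yf⇐ k h i c h≡ inOrbit left≤c c<right = fill⇐ (length ρ) (quota (h , toℕ i)) (toℕ c) (bound h i c) k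
      (subst (_≤ toℕ c) (sym prefix≡) left≤c)
      (subst (toℕ c <_) (sym (cong₂ _+_ prefix≡ (trans (same-quota k) (quota-top k)))) c<right)
      where
        same-quota = quota-inOrbit k h (toℕ i) h≡ inOrbit
        prefix≡ = prefix-cong (length ρ) same-quota k

    private
      exactly-one-row : ∀ h₀ x → x < length (μ h₀)
                      → ∑[ h < n ] ∑[ i < length (μ h) ] χ ((h₀ , x) ≟R (h , toℕ i)) ≡ 1
      exactly-one-row h₀ x x<len = begin
        ∑[ h < n ] ∑[ i < length (μ h) ] χ ((h₀ , x) ≟R (h , toℕ i))
          ≡⟨ ∑-single n _ h₀ (λ h h≢h₀ → ∑-zero (length (μ h)) λ i →
               χ-no ((h₀ , x) ≟R (h , toℕ i)) λ same → h≢h₀ (sym (cong proj₁ same))) ⟩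
        ∑[ i < length (μ h₀) ] χ ((h₀ , x) ≟R (h₀ , toℕ i))
          ≡⟨ sum-cong-≗ {length (μ h₀)} (λ i → χ-⇔ ((h₀ , x) ≟R (h₀ , toℕ i)) (toℕ i ≟ x) (sym ∘ cong proj₂) (cong (h₀ ,_) ∘ sym)) ⟩
        sumTo (length (μ h₀)) (λ i → χ (i ≟ x))
          ≡⟨ sumTo-χ-unique (length (μ h₀)) (λ i → i ≟ x) x x<len refl (λ _ _ eq → eq) ⟩
        1 ∎
        where open ≡-Reasoning

      orbitRow-exists : ∀ k t → t < ρ_ k → proj₂ (orbitRow (comp k) (r₀ k) t) < length (μ (comp k))
      orbitRow-exists k t t<ρk = at>0⇒<length (μ (comp k)) _ (begin-strict
        0                                   <⟨ s≤s z≤n ⟩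
        1                                   ≡⟨ χ-yes (R ≟R R) refl ⟨
        χ (R ≟R R)                          ≤⟨ ≤-sumTo (ρ_ k) (λ t' → χ (orbitRow (comp k) (r₀ k) t' ≟R R)) t t<ρk ⟩
        quota R k                           ≤⟨ ≤-∑ (length ρ) (quota R) k ⟩
        ∑[ k' < length ρ ] quota R k'       ≡⟨ ∑-quota R ⟩
        rowLen R                            ∎)
        where
          open ≤-Reasoning
          R = orbitRow (comp k) (r₀ k) t

    Yf-card : ∀ k → count (λ b → Yf b F.≟ k) allBoxes ≡ ρ_ k
    Yf-card k = begin
      count (λ b → Yf b F.≟ k) allBoxes
        ≡⟨ count-allBoxes (λ b → Yf b F.≟ k) ⟩
      ∑[ h < n ] ∑[ i < length (μ h) ] ∑[ c < lookup (μ h) i ] χ (Yf (h , i , c) F.≟ k)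
        ≡⟨ sum-cong-≗ (λ h → sum-cong-≗ λ i → count-fill (length ρ) (quota (h , toℕ i)) (lookup (μ h) i)
          (trans (lookup≡at (μ h) i) (sym (∑-quota (h , toℕ i)))) (bound h i) k) ⟩
      ∑[ h < n ] ∑[ i < length (μ h) ] ∑[ t < ρ_ k ] χ (orbitRow (comp k) (r₀ k) (toℕ t) ≟R (h , toℕ i))
        ≡⟨ sum-cong-≗ (λ h → ∑-comm {length (μ h)} {ρ_ k} (λ i t → χ (orbitRow (comp k) (r₀ k) (toℕ t) ≟R (h , toℕ i)))) ⟩
      ∑[ h < n ] ∑[ t < ρ_ k ] ∑[ i < length (μ h) ] χ (orbitRow (comp k) (r₀ k) (toℕ t) ≟R (h , toℕ i))
        ≡⟨ ∑-comm {n} {ρ_ k} (λ h t → ∑[ i < length (μ h) ] χ (orbitRow (comp k) (r₀ k) (toℕ t) ≟R (h , toℕ i))) ⟩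
      ∑[ t < ρ_ k ] ∑[ h < n ] ∑[ i < length (μ h) ] χ (orbitRow (comp k) (r₀ k) (toℕ t) ≟R (h , toℕ i))
        ≡⟨ sum-cong-≗ (λ t → exactly-one-row (comp k) _ (orbitRow-exists k (toℕ t) (toℕ<n t))) ⟩
      ∑[ t < ρ_ k ] 1
        ≡⟨ ∑-const (ρ_ k) 1 ⟩
      ρ_ k * 1
        ≡⟨ *-identityʳ (ρ_ k) ⟩
      ρ_ k ∎
      where open ≡-Reasoning

    Yf⁻¹⊆ : ∀ k b → Yf b ≡ k
          → ∃ λ s → ∃ λ t → s < γ (comp k) × t < width k × coords b ≡ (comp k , top k + s * O.d (comp k) , left k + t)
    Yf⁻¹⊆ k (h , i , c) Yf≡k = s , toℕ c ∸ left k , s<γ , t<w , cong₂ _,_ h≡ (cong₂ _,_ i≡ (sym (m+[n∸m]≡n left≤c)))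
      where
        props = Yf⇒ k h i c Yf≡k
        h≡ = proj₁ props
        left≤c = proj₁ (proj₂ (proj₂ props))
        in-row = InOrbit⇒progression k (toℕ i) (proj₁ (proj₂ props))
        s = proj₁ in-row
        s<γ = proj₁ (proj₂ in-row)
        i≡ = proj₂ (proj₂ in-row)
        t<w : toℕ c ∸ left k < width k
        t<w = +-cancelˡ-< (left k) _ _ (subst (_< left k + width k) (sym (m+[n∸m]≡n left≤c)) (proj₂ (proj₂ (proj₂ props))))

    Yf⁻¹⊇ : ∀ k s t → s < γ (comp k) → t < width k
          → Σ[ b ∈ Box ] (coords b ≡ (comp k , top k + s * O.d (comp k) , left k + t) × Yf b ≡ k)
    Yf⁻¹⊇ k s t s<γ t<w = b , coords-b , Yf⇐ k (comp k) (proj₁ (proj₂ b)) (proj₂ (proj₂ b)) refl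
      (subst (InOrbit k) (sym (cong (proj₁ ∘ proj₂) coords-b)) inOrbit)
      (subst (left k ≤_) (sym (cong (proj₂ ∘ proj₂) coords-b)) (m≤m+n (left k) t))
      (subst (_< left k + width k) (sym (cong (proj₂ ∘ proj₂) coords-b)) (+-monoʳ-< (left k) t<w))
      where
        x = top k + s * O.d (comp k)
        inOrbit = progression⇒InOrbit k s s<γ
        same-quota = quota-inOrbit k (comp k) x refl inOrbit
        right≤len : left k + width k ≤ at (μ (comp k)) x
        right≤len = subst (left k + width k ≤_) (∑-quota (comp k , x))
          (subst (_≤ ∑[ k' < length ρ ] quota (comp k , x) k')
                 (cong₂ _+_ (prefix-cong (length ρ) same-quota k) (trans (same-quota k) (quota-top k)))
            (prefix+≤∑ (length ρ) (quota (comp k , x)) k))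
        col<len : left k + t < at (μ (comp k)) x
        col<len = <-≤-trans (+-monoʳ-< (left k) t<w) right≤len
        x<len : x < length (μ (comp k))
        x<len = at>0⇒<length (μ (comp k)) x (≤-<-trans z≤n col<len)
        b = box (comp k) x (left k + t) x<len col<len
        coords-b = coords-box (comp k) x (left k + t) x<len col<len

    preimage : MarkedTabloid
    preimage = record
      { Y = Yf
      ; card = Yf-card
      ; shape = λ k → comp k , top k , left k , γ∣ρ k , Yf⁻¹⊆ k , Yf⁻¹⊇ k
      ; rowWeak = λ h i a b a≤b → fill-mono (length ρ) (quota (h , toℕ i)) (toℕ a) (toℕ b) (bound h i a) (bound h i b) a≤b
      ; c = λ k → comp k , fromℕ< (O.indexInOrbit<γ (comp k) (r₀ k))
      ; c-comp = λ k b Yf≡k → proj₁ (Yf⇒ k (proj₁ b) (proj₁ (proj₂ b)) (proj₂ (proj₂ b)) Yf≡k)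
      }

    φ-preimage : ∀ x → φ preimage x ≡ f x
    φ-preimage x = begin
      orbitRow (comp k) (Marked.start preimage k) t  ≡⟨ cong (λ r → orbitRow (comp k) r t) start≡r₀ ⟩
      orbitRow (comp k) (r₀ k) t                     ≡⟨ f-num k t (position-< x) ⟨
      f (num k t _)                                  ≡⟨ cong f (num-position x) ⟩
      f x                                            ∎
      where
        open ≡-Reasoning
        k = proj₁ (position x)
        t = proj₂ (position x)
        v = O.indexInOrbit (comp k) (r₀ k)
        v<γ = O.indexInOrbit<γ (comp k) (r₀ k)
        start≡r₀ : Marked.start preimage k ≡ r₀ k
        start≡r₀ = begin
          at (rowsOf Yf k) (toℕ (fromℕ< v<γ))
            ≡⟨ cong₂ at (Marked.rowsOf≡progression preimage k) (toℕ-fromℕ< v<γ) ⟩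
          at (progression (top k) (O.d (comp k)) (γ (comp k))) v
            ≡⟨ at-progression (top k) (O.d (comp k)) (γ (comp k)) v v<γ ⟩
          top k + v * O.d (comp k)
            ≡⟨ O.firstInOrbit+indexInOrbit*d (comp k) (r₀ k) ⟩
          r₀ k ∎

lemma4p7 : {n : ℕ} (ms ls : Fin n → ℕ) (μ : Fin n → List ℕ)
    → (∀ h → 0 < ms h) → (∀ h → 0 < ls h)
    → (∀ h → IsPartition (μ h) (ms h)) → (∀ h → IsLPartition (ls h) (μ h))
    → (ρ : List ℕ) (ρp : IsPartition ρ (sum (tabulate ms)))
    → (j : ℤ) (γ : Fin n → ℕ) → (∀ h → IsOrderOfPower (ls h) (μ h) j (γ h))
    → let open Setup μ ls γ ρ j (sum (tabulate ms)) (proj₂ (proj₂ ρp)) in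
      ((P : MarkedTabloid) → IsTabloid (φ P) × Cond (φ P))
      × ((P Q : MarkedTabloid) → (∀ x → φ P x ≡ φ Q x) → SameMarked P Q)
      × ((f : Fin (sum (tabulate ms)) → Row) → IsTabloid f → Cond f
           → Σ[ P ∈ MarkedTabloid ] (∀ x → φ P x ≡ f x))
lemma4p7 ms ls μ ms>0 ls>0 μ-partition _ ρ ρ-partition j γ γ-order =
    (λ P → Marked.φ-isTabloid P , Marked.φ-cond P)
  , φ-injective
  , λ f f-tabloid f-cond → Preimage.preimage f f-tabloid f-cond , Preimage.φ-preimage f f-tabloid f-cond
  where
    open ListFacts using (partition-head>0)
    open Tabloids μ ls γ ρ j (sum (tabulate ms)) (proj₂ (proj₂ ρ-partition)) ls>0 (proj₁ ∘ μ-partition)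
                  (λ h → partition-head>0 (μ-partition h) (ms>0 h)) (proj₁ (proj₂ ρ-partition)) γ-order
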